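{- Let $b > 2$. The digraph $G_b'$ is well-defined (that is, for each vertex $(d,u,[\kappa])$, whether $(d,u,k)$ has an outgoing edge in $G_b$, and if so the values $d'$, $u'$ and the class of $k'$ of its target, are the same for all sufficiently large $k \equiv \kappa \pmod{L(b)}$), and every vertex of $G_b'$ has in-degree at most $1$ and out-degree at most $1$.
   Context: Base-$b$ generalized comma sequence: for a positive integer $v$, $a(1)=v$ and for $n>1$, with $x$ the last base-$b$ digit of $a(n-1)$, $a(n) = a(n-1)+bx+y$ where $y\in\{0,\dots,b-1\}$ must be the most significant base-$b$ digit of $a(n)$ and is the smallest such; if none exists the sequence terminates. Since the rule is deterministic, each positive integer $N$ determines the comma sequence starting at $N$. For a digit $d\in\{1,\dots,b-1\}$, writing $(r,s)_b = rb+s$ for digits $r,s$, let $U(b,d) = \{(r,s)_b : r+s<b,\ 0<s<b\}\cup\{(r,s)_b : r+s=b,\ s<d\}$ if $d\ne1$, and $U(b,1)=\{(r,s)_b: r+s\le b,\ 0<s<b\}$. The digraph $G_b$ has vertices $(d,u,k)$ with $d\in\{1,\dots,b-1\}$, $u\in U(b,d)$, $k\ge 0$ an integer; the vertex represents the integer $d\,b^k-u$. Put $(d',k')=(d+1,k)$ if $d<b-1$ and $(d',k')=(1,k+1)$ if $d=b-1$. There is an edge $(d,u,k)\to(d',u',k')$ iff the comma sequence starting at $d\,b^k - u$ has a term in $[d' b^{k'}-b^2,\ d'b^{k'})$ and its last term in that interval is $d'b^{k'}-u'$ (these are the only edges). For $d,u$ let $S_b(d,u)=\{((md-u)\bmod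 b)\,b+d : 0\le m< b/\gcd(b,d)\}$ and let $\Sigma(d,u)$ be the sum of its elements. The sequence $k\mapsto b^k \bmod \Sigma(d,u)$ is eventually periodic; let $l(d,u)$ be its eventual period, and $L(b)=\operatorname{lcm}\{l(d,u): 1\le d<b,\ u\in U(b,d)\cup\{0\}\}$. The digraph $G_b'$ has vertices $(d,u,[\kappa])$ with $d\in\{1,\dots,b-1\}$, $u\in U(b,d)$ and $[\kappa]$ a residue class modulo $L(b)$; there is an edge $(d,u,[\kappa])\to(d',u',[\kappa'])$ iff the edge $(d,u,k)\to(d',u',k')$ exists in $G_b$ for sufficiently large integers $k\equiv\kappa$, $k'\equiv\kappa' \pmod{L(b)}$. -}

module Defs where

open import Data.Nat using (ℕ; zero; suc; _+_; _*_; _∸_; _^_; _≤_; _<_; NonZero; _<ᵇ_; _≟_)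
open import Data.Nat.DivMod using (_/_; _%_)
open import Data.Nat.GCD using (gcd; gcd[m,n]≢0)
open import Data.Nat.Divisibility using (_∣_)
import Data.Nat.Base as NB
open import Data.Integer using (ℤ; +_) renaming (_-_ to _-ℤ_)
open import Data.Integer.DivMod using (_%ℕ_)
open import Data.Bool using (Bool; true; false; if_then_else_)
open import Data.Maybe using (Maybe; just; nothing)
open import Data.List using (List; map; upTo; deduplicate)
open import Data.Nat.ListAction using (sum)
open import Data.Product using (Σ; ∃; _×_; _,_)
open import Data.Sum using (_⊎_; inj₁)
open import Relation.Binary.PropositionalEquality using (_≡_)
open import Relation.Nullary using (¬_)

leadF : (b : ℕ) .{{_ : NonZero b}} → ℕ → ℕ → ℕ
leadF b zero    m = m
leadF b (suc f) m = if m <ᵇ b then m else leadF b f (m / b)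

lead : (b : ℕ) .{{_ : NonZero b}} → ℕ → ℕ
lead b m = leadF b m m

firstBelow : (ℕ → Bool) → ℕ → Maybe ℕ
firstBelow p zero = nothing
firstBelow p (suc n) with firstBelow p n
... | just y  = just y
... | nothing = if p n then just n else nothing

eqᵇ : ℕ → ℕ → Bool
eqᵇ = NB._≡ᵇ_

-- next term of the comma sequence after a (nothing = termination)
next : (b : ℕ) .{{_ : NonZero b}} → ℕ → Maybe ℕ
next b a with firstBelow (λ y → eqᵇ (lead b (a + b * (a % b) + y)) y) b
... | just y  = just (a + b * (a % b) + y)
... | nothing = nothing

-- term b N n : the (n+1)-st term of the comma sequence starting at N
term : (b : ℕ) .{{_ : NonZero b}} → ℕ → ℕ → Maybe ℕ
term b N zero = just N
term b N (suc n) with term b N n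
... | just a  = next b a
... | nothing = nothing

LastIn : (b : ℕ) .{{_ : NonZero b}} → ℕ → ℕ → ℕ → ℕ → Set
LastIn b N lo hi t =
  ∃ λ n → term b N n ≡ just t × lo ≤ t × t < hi ×
    (∀ m t₂ → n < m → term b N m ≡ just t₂ → ¬ (lo ≤ t₂ × t₂ < hi))

InU : ℕ → ℕ → ℕ → Set
InU b d u = Σ ℕ λ r → Σ ℕ λ s → r < b × s < b × u ≡ r * b + s × cond r s d
  where
  cond : ℕ → ℕ → ℕ → Set
  cond r s (suc zero) = r + s ≤ b × 0 < s
  cond r s _          = (r + s < b × 0 < s) ⊎ (r + s ≡ b × s < d)

nextDK : ℕ → ℕ → ℕ → ℕ × ℕ
nextDK b d k = if suc d <ᵇ b then (suc d , k) else (1 , suc k)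

Edge : (b : ℕ) .{{_ : NonZero b}} → ℕ → ℕ → ℕ → ℕ → ℕ → ℕ → Set
Edge b d u k d' u' k' =
  nextDK b d k ≡ (d' , k') × InU b d' u' ×
  LastIn b (d * b ^ k ∸ u) (d' * b ^ k' ∸ b ^ 2) (d' * b ^ k') (d' * b ^ k' ∸ u')

IsVtx : ℕ → ℕ → ℕ → Set
IsVtx b d u = 1 ≤ d × d < b × InU b d u

S : (b : ℕ) .{{_ : NonZero b}} → ℕ → ℕ → List ℕ
S b d u = map (λ m → (((+ (m * d)) -ℤ (+ u)) %ℕ b) * b + d) (upTo (_/_ b (gcd b d) {{gnz}}))
  where
  gnz : NonZero (gcd b d)
  gnz = NB.≢-nonZero (gcd[m,n]≢0 b d (inj₁ (NB.≢-nonZero⁻¹ b)))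

Sig : (b : ℕ) .{{_ : NonZero b}} → ℕ → ℕ → ℕ
Sig b d u = sum (deduplicate _≟_ (S b d u))

-- a mod M (for M = 0 returns a; only used with M ≥ 1)
modN : ℕ → ℕ → ℕ
modN a zero    = a
modN a (suc M) = a % suc M

EvPer : (ℕ → ℕ) → ℕ → Set
EvPer f p = ∃ λ K → ∀ k → K ≤ k → f (k + p) ≡ f k

IsEventualPeriod : (ℕ → ℕ) → ℕ → Set
IsEventualPeriod f p = 0 < p × EvPer f p × (∀ q → 0 < q → EvPer f q → p ≤ q)

CommonMult : (b : ℕ) .{{_ : NonZero b}} → ℕ → Set
CommonMult b M = ∀ d u l → 1 ≤ d → d < b → (InU b d u ⊎ u ≡ 0) →
  IsEventualPeriod (λ k → modN (b ^ k) (Sig b d u)) l → l ∣ M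

IsL : (b : ℕ) .{{_ : NonZero b}} → ℕ → Set
IsL b L = CommonMult b L × (∀ M → CommonMult b M → L ∣ M)

InClass : ℕ → ℕ → ℕ → Set
InClass L k κ = ∃ λ q → k ≡ κ + q * L

IsVtx' : ℕ → ℕ → ℕ → ℕ → ℕ → Set
IsVtx' b L d u κ = IsVtx b d u × κ < L

Edge' : (b : ℕ) .{{_ : NonZero b}} → ℕ → ℕ → ℕ → ℕ → ℕ → ℕ → ℕ → Set
Edge' b L d u κ d' u' κ' = ∃ λ K → ∀ k → K ≤ k → InClass L k κ →
  ∃ λ k' → InClass L k' κ' × Edge b d u k d' u' k'

WellDefinedAt : (b : ℕ) .{{_ : NonZero b}} → ℕ → ℕ → ℕ → ℕ → Set
WellDefinedAt b L d u κ = ∃ λ K →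
    (∀ k → K ≤ k → InClass L k κ → ∀ d' u' k' → ¬ Edge b d u k d' u' k')
  ⊎ (∃ λ d' → ∃ λ u' → ∃ λ κ' → κ' < L ×
       (∀ k → K ≤ k → InClass L k κ → ∃ λ k' → Edge b d u k d' u' k')
     × (∀ k → K ≤ k → InClass L k κ → ∀ d'' u'' k'' → Edge b d u k d'' u'' k'' →
          d'' ≡ d' × u'' ≡ u' × InClass L k'' κ'))

-- Fix a vertex (d, u) and put A = d * b ^ k with k ≥ 2. Writing u = r * b + s, a direct computation shows
-- that the comma sequence from A - u either stops at once or jumps to A + e, with an offset e < b ^ 2
-- independent of k. While it stays below (d+1) * b ^ k every step adds b * (last digit) + d, so the walk
-- is A plus the walk from e, and the exit gap u' = b ^ k - (last point of the walk below b ^ k) does not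
-- change when b ^ k grows by the sum Σ of one cycle of increments, which is Σ(d, u). Hence u' depends
-- only on b ^ k mod Σ(d, u), that is, eventually only on k mod L(b).
-- Out-degree ≤ 1 is uniqueness of the last term in a window. For in-degree ≤ 1, the successor map of
-- comma sequences is injective, so of two sequences sharing a term one contains the start of the other;
-- but the sequence from d * b ^ k - u has no term below d * b ^ k except its start.

module Submission where

open import Defs
open import Data.Nat using (ℕ; _<_; NonZero)
open import Data.Product using (_×_)
open import Relation.Binary.PropositionalEquality using (_≡_)

open import Data.Bool using (Bool; true; false; T)
open import Data.Empty using (⊥-elim)
open import Data.Fin using (toℕ; fromℕ<)
open import Data.Fin.Properties using (pigeonhole; toℕ-fromℕ<; toℕ<n)
open import Data.List using ([]; _∷_; _∷ʳ_; applyUpTo; deduplicate)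
open import Data.List.Properties using (filter-all; applyUpTo-∷ʳ; map-upTo)
open import Data.List.Relation.Unary.AllPairs using (AllPairs; []; _∷_)
import Data.List.Relation.Unary.AllPairs.Properties as AllPairs
open import Data.Maybe using (just; nothing)
open import Data.Maybe.Properties using (just-injective)
open import Data.Nat
open import Data.Nat.DivMod
open import Data.Nat.Coprimality using (coprime-/gcd; coprime-divisor)
open import Data.Nat.Divisibility
  using (_∣_; divides; m%n≡0⇒n∣m; n∣m⇒m%n≡0; ∣⇒≤; *-cancelˡ-∣; m∣m*n; ∣m∣n⇒∣m+n)
open import Data.Nat.GCD using (gcd; gcd[m,n]∣m; gcd[m,n]∣n; gcd[m,n]≢0)
open import Data.Integer using (-[1+_])
import Data.Integer as ℤ
open import Data.Integer.DivMod using (_%ℕ_; n%ℕd<d)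
import Data.Integer.Properties as ℤ
open import Data.Nat.ListAction using (sum)
open import Data.Nat.ListAction.Properties using (sum-++)
open import Data.Nat.Properties
open import Data.Nat.Tactic.RingSolver using (solve-∀)
open import Data.Product using (Σ; ∃; _,_; proj₁; proj₂; map₂)
open import Data.Sum using (_⊎_; inj₁; inj₂; [_,_]′)
open import Function using (_∘_)
open import Relation.Binary.PropositionalEquality
open import Relation.Binary.Definitions using (tri<; tri≈; tri>)
open import Relation.Nullary using (¬_; Dec; yes; no; ¬?)
open import Relation.Nullary.Decidable using (_×-dec_; _⊎-dec_)

module Residues (m : ℕ) .{{_ : NonZero m}} where

  [m%n+o]%n≡[m+o]%n : ∀ x y → (x % m + y) % m ≡ (x + y) % m
  [m%n+o]%n≡[m+o]%n x y = begin
    (x % m + y) % m         ≡⟨ %-distribˡ-+ (x % m) y m ⟩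
    (x % m % m + y % m) % m ≡⟨ cong (λ z → (z + y % m) % m) (m%n%n≡m%n x m) ⟩
    (x % m + y % m) % m     ≡⟨ %-distribˡ-+ x y m ⟨
    (x + y) % m             ∎
    where open ≡-Reasoning

  [m+o%n]%n≡[m+o]%n : ∀ x y → (x + y % m) % m ≡ (x + y) % m
  [m+o%n]%n≡[m+o]%n x y rewrite +-comm x (y % m) | +-comm x y = [m%n+o]%n≡[m+o]%n y x

  -- Adding (m ∸ 1) * u turns + u into + u * m, which is invisible mod m.
  %-cancelʳ-+ : ∀ x y u → (x + u) % m ≡ (y + u) % m → x % m ≡ y % m
  %-cancelʳ-+ x y u eq = begin
    x % m                           ≡⟨ [m+kn]%n≡m%n x u m ⟨
    (x + u * m) % m                 ≡⟨ cong (_% m) (absorb x) ⟩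
    (x + u + (m ∸ 1) * u) % m       ≡⟨ [m%n+o]%n≡[m+o]%n (x + u) _ ⟨
    ((x + u) % m + (m ∸ 1) * u) % m ≡⟨ cong (λ z → (z + (m ∸ 1) * u) % m) eq ⟩
    ((y + u) % m + (m ∸ 1) * u) % m ≡⟨ [m%n+o]%n≡[m+o]%n (y + u) _ ⟩
    (y + u + (m ∸ 1) * u) % m       ≡⟨ cong (_% m) (absorb y) ⟨
    (y + u * m) % m                 ≡⟨ [m+kn]%n≡m%n y u m ⟩
    y % m                           ∎
    where
    open ≡-Reasoning
    absorb : ∀ z → z + u * m ≡ z + u + (m ∸ 1) * u
    absorb z = begin
      z + u * m             ≡⟨ cong (λ n → z + u * n) (m∸n+n≡m {m} {1} (>-nonZero⁻¹ m)) ⟨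
      z + u * (m ∸ 1 + 1)   ≡⟨ lemma z u (m ∸ 1) ⟩
      z + u + (m ∸ 1) * u   ∎
      where lemma : ∀ z u n → z + u * (n + 1) ≡ z + u + n * u
            lemma = solve-∀

  %-cancelˡ-+ : ∀ u x y → (u + x) % m ≡ (u + y) % m → x % m ≡ y % m
  %-cancelˡ-+ u x y rewrite +-comm u x | +-comm u y = %-cancelʳ-+ x y u

  [m+n]%o≡m%o⇒o∣n : ∀ y z → (y + z) % m ≡ y % m → m ∣ z
  [m+n]%o≡m%o⇒o∣n y z eq = m%n≡0⇒n∣m z m (trans (%-cancelˡ-+ y z 0 (trans eq (cong (_% m) (sym (+-identityʳ y)))))
                                                  (m<n⇒m%n≡m (>-nonZero⁻¹ m)))

  [m*[n%o]]%o≡[m*n]%o : ∀ x y → (x * (y % m)) % m ≡ (x * y) % m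
  [m*[n%o]]%o≡[m*n]%o x y = begin
    (x * (y % m)) % m            ≡⟨ %-distribˡ-* x (y % m) m ⟩
    (x % m * (y % m % m)) % m    ≡⟨ cong (λ z → (x % m * z) % m) (m%n%n≡m%n y m) ⟩
    (x % m * (y % m)) % m        ≡⟨ %-distribˡ-* x y m ⟨
    (x * y) % m                  ∎
    where open ≡-Reasoning

  %≡⇒+* : ∀ {x y} → x % m ≡ y % m → x ≤ y → ∃ λ q → y ≡ x + q * m
  %≡⇒+* {x} {y} eq x≤y = q , (begin
    y                               ≡⟨ m≡m%n+[m/n]*n y m ⟩
    y % m + y / m * m               ≡⟨ cong₂ (λ r z → r + z * m) (sym eq) (sym (m+[n∸m]≡n (/-monoˡ-≤ m x≤y))) ⟩
    x % m + (x / m + q) * m         ≡⟨ distrib (x % m) (x / m) q m ⟩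
    x % m + x / m * m + q * m       ≡⟨ cong (_+ q * m) (m≡m%n+[m/n]*n x m) ⟨
    x + q * m                       ∎)
    where
    open ≡-Reasoning
    q : ℕ
    q = y / m ∸ x / m
    distrib : ∀ r a q m → r + (a + q) * m ≡ r + a * m + q * m
    distrib = solve-∀

  [-[1+n]%ℕm+[1+n]]%m≡0 : ∀ n → (-[1+ n ] %ℕ m + suc n) % m ≡ 0
  [-[1+n]%ℕm+[1+n]]%m≡0 n with suc n % m in eq
  ... | zero  = eq
  ... | suc r = begin
    (m ∸ suc r + suc n) % m       ≡⟨ [m+o%n]%n≡[m+o]%n (m ∸ suc r) (suc n) ⟨
    (m ∸ suc r + suc n % m) % m   ≡⟨ cong (λ z → (m ∸ suc r + z) % m) eq ⟩
    (m ∸ suc r + suc r) % m       ≡⟨ cong (_% m) (m∸n+n≡m (<⇒≤ (subst (_< m) eq (m%n<n (suc n) m)))) ⟩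
    m % m                         ≡⟨ n%n≡0 m ⟩
    0                             ∎
    where open ≡-Reasoning

  [[a-u]%ℕm+u]%m≡a%m : ∀ a u → ((ℤ.+ a ℤ.- ℤ.+ u) %ℕ m + u) % m ≡ a % m
  [[a-u]%ℕm+u]%m≡a%m a u rewrite ℤ.m-n≡m⊖n a u with u ≤? a
  ... | yes u≤a rewrite ℤ.⊖-≥ u≤a = trans ([m%n+o]%n≡[m+o]%n (a ∸ u) u) (cong (_% m) (m∸n+n≡m u≤a))
  ... | no  u≰a rewrite ℤ.⊖-< (≰⇒> u≰a) with u ∸ a in diff
  ...   | zero  = ⊥-elim (<⇒≢ (m<n⇒0<n∸m (≰⇒> u≰a)) (sym diff))
  ...   | suc n = begin
    (-[1+ n ] %ℕ m + u) % m                ≡⟨ cong (λ z → (-[1+ n ] %ℕ m + z) % m) u≡ ⟩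
    (-[1+ n ] %ℕ m + (a + suc n)) % m      ≡⟨ cong (_% m) (rearrange (-[1+ n ] %ℕ m) a (suc n)) ⟩
    (a + (-[1+ n ] %ℕ m + suc n)) % m      ≡⟨ [m+o%n]%n≡[m+o]%n a _ ⟨
    (a + (-[1+ n ] %ℕ m + suc n) % m) % m  ≡⟨ cong (λ z → (a + z) % m) ([-[1+n]%ℕm+[1+n]]%m≡0 n) ⟩
    (a + 0) % m                            ≡⟨ cong (_% m) (+-identityʳ a) ⟩
    a % m                                  ∎
    where
    open ≡-Reasoning
    u≡ : u ≡ a + suc n
    u≡ = trans (sym (m+[n∸m]≡n (<⇒≤ (≰⇒> u≰a)))) (cong (a +_) diff)
    rearrange : ∀ r a n → r + (a + n) ≡ a + (r + n)
    rearrange = solve-∀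

  <⇒%-injective : ∀ {x y} → x < m → y < m → x % m ≡ y % m → x ≡ y
  <⇒%-injective {x} {y} x<m y<m eq = trans (sym (m<n⇒m%n≡m x<m)) (trans eq (m<n⇒m%n≡m y<m))

sumBelow : (ℕ → ℕ) → ℕ → ℕ
sumBelow f zero    = 0
sumBelow f (suc n) = sumBelow f n + f n

sumBelow-cong : ∀ {f g} n → (∀ j → f j ≡ g j) → sumBelow f n ≡ sumBelow g n
sumBelow-cong zero    eq = refl
sumBelow-cong (suc n) eq = cong₂ _+_ (sumBelow-cong n eq) (eq n)

sumBelow-shift : ∀ f n → sumBelow (f ∘ suc) n + f 0 ≡ sumBelow f n + f n
sumBelow-shift f zero    = refl
sumBelow-shift f (suc n) = begin
  sumBelow (f ∘ suc) n + f (suc n) + f 0 ≡⟨ swap (sumBelow (f ∘ suc) n) (f (suc n)) (f 0) ⟩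
  sumBelow (f ∘ suc) n + f 0 + f (suc n) ≡⟨ cong (_+ f (suc n)) (sumBelow-shift f n) ⟩
  sumBelow f n + f n + f (suc n)         ∎
  where open ≡-Reasoning
        swap : ∀ a x y → a + x + y ≡ a + y + x
        swap = solve-∀

sumBelow-affine : ∀ b d h n → sumBelow (λ j → b * h j + d) n ≡ b * sumBelow h n + n * d
sumBelow-affine b d h zero    = sym (trans (+-identityʳ (b * 0)) (*-zeroʳ b))
sumBelow-affine b d h (suc n) rewrite sumBelow-affine b d h n = lemma b (sumBelow h n) (h n) n d
  where lemma : ∀ b s x n d → b * s + n * d + (b * x + d) ≡ b * (s + x) + (d + n * d)
        lemma = solve-∀

sum-applyUpTo : ∀ f n → sum (applyUpTo f n) ≡ sumBelow f n
sum-applyUpTo f zero    = refl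
sum-applyUpTo f (suc n) = begin
  sum (applyUpTo f (suc n))       ≡⟨ cong sum (applyUpTo-∷ʳ f n) ⟨
  sum (applyUpTo f n ∷ʳ f n)      ≡⟨ sum-++ (applyUpTo f n) (f n ∷ []) ⟩
  sum (applyUpTo f n) + (f n + 0) ≡⟨ cong₂ _+_ (sum-applyUpTo f n) (+-identityʳ (f n)) ⟩
  sumBelow f n + f n              ∎
  where open ≡-Reasoning

deduplicate-distinct : ∀ xs → AllPairs _≢_ xs → deduplicate _≟_ xs ≡ xs
deduplicate-distinct []       []         = refl
deduplicate-distinct (x ∷ xs) (x∉ ∷ xs!) rewrite deduplicate-distinct xs xs! =
  cong (x ∷_) (filter-all (¬? ∘ (x ≟_)) x∉)

[m+o]∸[n+o]≡m∸n : ∀ m o n → (m + o) ∸ (n + o) ≡ m ∸ n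
[m+o]∸[n+o]≡m∸n m o n rewrite +-comm m o | +-comm n o = [m+n]∸[m+o]≡n∸o o m n

[m+n]∸[m∸o]≡o+n : ∀ {m o} n → o ≤ m → (m + n) ∸ (m ∸ o) ≡ o + n
[m+n]∸[m∸o]≡o+n {m} {o} n o≤m = begin
  (m + n) ∸ (m ∸ o)               ≡⟨ cong (λ z → (z + n) ∸ (m ∸ o)) (m∸n+n≡m o≤m) ⟨
  (m ∸ o + o + n) ∸ (m ∸ o)       ≡⟨ cong (_∸ (m ∸ o)) (+-assoc (m ∸ o) o n) ⟩
  (m ∸ o + (o + n)) ∸ (m ∸ o)     ≡⟨ m+n∸m≡n (m ∸ o) (o + n) ⟩
  o + n                           ∎
  where open ≡-Reasoning

modN≡% : ∀ x S .{{_ : NonZero S}} → modN x S ≡ x % S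
modN≡% x (suc S) = refl

module _ {f : ℕ → ℕ} {p : ℕ} where

  EvPer-+* : ((K , per) : EvPer f p) → ∀ x → K ≤ x → ∀ q → f (x + q * p) ≡ f x
  EvPer-+* (K , per) x K≤x zero    = cong f (+-identityʳ x)
  EvPer-+* (K , per) x K≤x (suc q) = begin
    f (x + (p + q * p)) ≡⟨ cong f (lemma x p (q * p)) ⟩
    f (x + q * p + p)   ≡⟨ per (x + q * p) (≤-trans K≤x (m≤m+n x _)) ⟩
    f (x + q * p)       ≡⟨ EvPer-+* (K , per) x K≤x q ⟩
    f x                 ∎
    where open ≡-Reasoning
          lemma : ∀ x p y → x + (p + y) ≡ x + y + p
          lemma = solve-∀

-- An orbit of a self-map of {0, …, M-1} repeats by pigeonhole, hence has a least eventual period.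
module Orbit (f h : ℕ → ℕ) (M : ℕ) (f-suc : ∀ k → f (suc k) ≡ h (f k)) (f<M : ∀ k → f k < M) where

  repeatsFrom : ∀ a p → f (a + p) ≡ f a → EvPer f p
  repeatsFrom a p eq = a , λ x a≤x → subst (λ z → f (z + p) ≡ f z) (m+[n∸m]≡n a≤x) (go (x ∸ a))
    where
    go : ∀ t → f (a + t + p) ≡ f (a + t)
    go zero    rewrite +-identityʳ a = eq
    go (suc t) rewrite +-suc a t = trans (f-suc _) (trans (cong h (go t)) (sym (f-suc _)))

  repetition : Σ ℕ λ i → Σ ℕ λ p → i ≤ M × 0 < p × f (i + p) ≡ f i
  repetition with pigeonhole (n<1+n M) (λ i → fromℕ< (f<M (toℕ i)))
  ... | i , j , i<j , eq = toℕ i , toℕ j ∸ toℕ i , m<1+n⇒m≤n (toℕ<n i) , m<n⇒0<n∸m i<j ,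
        trans (cong f (m+[n∸m]≡n (<⇒≤ i<j)))
              (sym (trans (sym (toℕ-fromℕ< (f<M (toℕ i)))) (trans (cong toℕ eq) (toℕ-fromℕ< (f<M (toℕ j))))))

  -- Beyond M every eventual period q already satisfies f (M + q) ≡ f M, which is decidable.
  PeriodAtM : ℕ → Set
  PeriodAtM q = f (M + q) ≡ f M

  EvPer⇒PeriodAtM : ∀ q → EvPer f q → PeriodAtM q
  EvPer⇒PeriodAtM q ev@(K , per) with repetition
  ... | i , p , i≤M , p>0 , eq = begin
    f (M + q)          ≡⟨ EvPer-+* (repeatsFrom i p eq) (M + q) (≤-trans i≤M (m≤m+n M q)) K ⟨
    f (M + q + K * p)  ≡⟨ cong f (swap M q (K * p)) ⟩
    f (M + K * p + q)  ≡⟨ per (M + K * p) (≤-trans (m≤m*n K p {{>-nonZero p>0}}) (m≤n+m (K * p) M)) ⟩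
    f (M + K * p)      ≡⟨ EvPer-+* (repeatsFrom i p eq) M i≤M K ⟩
    f M                ∎
    where open ≡-Reasoning
          swap : ∀ a b c → a + b + c ≡ a + c + b
          swap = solve-∀

  leastPeriodAtM≤ : ∀ n → (Σ ℕ λ q → 0 < q × PeriodAtM q × (∀ q' → 0 < q' → q' < q → ¬ PeriodAtM q'))
                        ⊎ (∀ q → 0 < q → q ≤ n → ¬ PeriodAtM q)
  leastPeriodAtM≤ zero = inj₂ (λ q q>0 q≤0 _ → <⇒≱ q>0 q≤0)
  leastPeriodAtM≤ (suc n) with leastPeriodAtM≤ n
  ... | inj₁ found = inj₁ found
  ... | inj₂ none with f (M + suc n) ≟ f M
  ...   | yes eq = inj₁ (suc n , z<s , eq , λ q' q'>0 q'<1+n → none q' q'>0 (m<1+n⇒m≤n q'<1+n))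
  ...   | no neq = inj₂ λ q q>0 q≤1+n → [ (λ q<1+n → none q q>0 (m<1+n⇒m≤n q<1+n)) , (λ { refl → neq }) ]′
                                            (m≤n⇒m<n∨m≡n q≤1+n)

  eventualPeriod : Σ ℕ (IsEventualPeriod f)
  eventualPeriod with repetition
  ... | i , p , i≤M , p>0 , eq with leastPeriodAtM≤ p
  ...   | inj₁ (q , q>0 , atM , least) =
          q , q>0 , repeatsFrom M q atM , λ q' q'>0 ev → ≮⇒≥ λ q'<q → least q' q'>0 q'<q (EvPer⇒PeriodAtM q' ev)
  ...   | inj₂ none = ⊥-elim (none p p>0 ≤-refl (EvPer⇒PeriodAtM p (repeatsFrom i p eq)))

powMod-periodic : ∀ b S L → 0 < S → (∀ l → IsEventualPeriod (λ k → modN (b ^ k) S) l → l ∣ L) →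
  ∃ λ K → ∀ k q → K ≤ k → modN (b ^ (k + q * L)) S ≡ modN (b ^ k) S
powMod-periodic b S@(suc _) L _ divides-L
  with Orbit.eventualPeriod (λ k → b ^ k % S) (λ v → b * v % S) S
         (λ k → sym (Residues.[m*[n%o]]%o≡[m*n]%o S b (b ^ k))) (λ k → m%n<n (b ^ k) S)
... | l , l-per with divides-L l l-per | l-per
... | divides m refl | _ , ev@(K , _) , _ = K , λ k q K≤k →
  trans (cong (λ z → b ^ (k + z) % S) (sym (*-assoc q m l))) (EvPer-+* ev k K≤k (q * m))

module _ (p : ℕ → Bool) where

  firstBelow-nothing : ∀ n → (∀ y → y < n → p y ≡ false) → firstBelow p n ≡ nothing
  firstBelow-nothing zero    none = refl
  firstBelow-nothing (suc n) none
    rewrite firstBelow-nothing n (λ y y<n → none y (m<n⇒m<1+n y<n)) | none n (n<1+n n) = refl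

  firstBelow-just : ∀ {n y} → y < n → p y ≡ true → (∀ z → z < y → p z ≡ false) → firstBelow p n ≡ just y
  firstBelow-just {suc n} {y} y<1+n py below with m<1+n⇒m<n∨m≡n y<1+n
  ... | inj₁ y<n  rewrite firstBelow-just y<n py below = refl
  ... | inj₂ refl rewrite firstBelow-nothing y below | py = refl

  firstBelow-sound : ∀ n {y} → firstBelow p n ≡ just y → p y ≡ true × y < n
  firstBelow-sound (suc n) eq with firstBelow p n in found
  ... | just _ with refl ← eq = map₂ m<n⇒m<1+n (firstBelow-sound n found)
  ... | nothing with p n in pn
  ...   | true  with refl ← eq = pn , n<1+n n
  ...   | false with () ← eq

eqᵇ-true : ∀ {m n} → m ≡ n → eqᵇ m n ≡ true
eqᵇ-true {m} {n} eq with eqᵇ m n in e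
... | true  = refl
... | false = ⊥-elim (subst T e (≡⇒≡ᵇ m n eq))

eqᵇ-false : ∀ {m n} → m ≢ n → eqᵇ m n ≡ false
eqᵇ-false {m} {n} neq with eqᵇ m n in e
... | true  = ⊥-elim (neq (≡ᵇ⇒≡ m n (subst T (sym e) _)))
... | false = refl

module CommaSequence (b : ℕ) .{{_ : NonZero b}} (1<b : 1 < b) where

  open Residues b

  advance : ℕ → ℕ → ℕ
  advance a y = a + b * (a % b) + y

  a≤advance : ∀ a y → a ≤ advance a y
  a≤advance a y = ≤-trans (m≤m+n a (b * (a % b))) (m≤m+n _ y)

  advance-mono : ∀ a {y z} → y ≤ z → advance a y ≤ advance a z
  advance-mono a = +-monoʳ-≤ (a + b * (a % b))

  k<b^k : ∀ k → k < b ^ k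
  k<b^k zero    = z<s
  k<b^k (suc k) = begin-strict
    suc k           ≤⟨ k<b^k k ⟩
    b ^ k           <⟨ m<m+n (b ^ k) (m^n>0 b k) ⟩
    b ^ k + b ^ k   ≡⟨ cong (b ^ k +_) (+-identityʳ (b ^ k)) ⟨
    2 * b ^ k       ≤⟨ *-monoˡ-≤ (b ^ k) 1<b ⟩
    b * b ^ k       ∎
    where open ≤-Reasoning

  *b≤⇒≤/b : ∀ {x v} → x * b ≤ v → x ≤ v / b
  *b≤⇒≤/b {x} {v} le = subst (_≤ v / b) (m*n/n≡m x b) (/-monoˡ-≤ b le)

  b≤b^k : ∀ {k} → 1 ≤ k → b ≤ b ^ k
  b≤b^k {suc k} _ = m≤m*n b (b ^ k) {{>-nonZero (m^n>0 b k)}}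

  b^2≤b^k : ∀ {k} → 2 ≤ k → b ^ 2 ≤ b ^ k
  b^2≤b^k = ^-monoʳ-≤ b

  1+[b∸1]≡b : suc (b ∸ 1) ≡ b
  1+[b∸1]≡b = trans (+-comm 1 (b ∸ 1)) (m∸n+n≡m (<⇒≤ 1<b))

  s<b⇒s≤b∸1 : ∀ {s} → s < b → s ≤ b ∸ 1
  s<b⇒s≤b∸1 {s} s<b = m<1+n⇒m≤n (subst (s <_) (sym 1+[b∸1]≡b) s<b)

  r+s≡b⇒0<s : ∀ {r s} → r < b → r + s ≡ b → 0 < s
  r+s≡b⇒0<s {r} r<b r+s≡b =
    ≰⇒> λ s≤0 → <⇒≢ r<b (trans (sym (+-identityʳ r)) (trans (cong (r +_) (sym (n≤0⇒n≡0 s≤0))) r+s≡b))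

  d*b^[1+k]≡d*b^k*b : ∀ d k → d * b ^ suc k ≡ d * b ^ k * b
  d*b^[1+k]≡d*b^k*b d k rewrite *-comm b (b ^ k) = sym (*-assoc d (b ^ k) b)

  leadF-digit : ∀ {k d v} f → 0 < d → d < b → d * b ^ k ≤ v → v < suc d * b ^ k → k ≤ f → leadF b f v ≡ d
  leadF-digit {zero} {d} {v} f 0<d d<b lo hi _ = go f
    where
    v≡d : v ≡ d
    v≡d = ≤-antisym (m<1+n⇒m≤n (subst (v <_) (*-identityʳ (suc d)) hi)) (subst (_≤ v) (*-identityʳ d) lo)
    go : ∀ f → leadF b f v ≡ d
    go zero    = v≡d
    go (suc f) with v <ᵇ b in v<ᵇb
    ... | true  = v≡d
    ... | false = ⊥-elim (subst T v<ᵇb (<⇒<ᵇ (subst (_< b) (sym v≡d) d<b)))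
  leadF-digit {suc k} {d} {v} (suc f) 0<d d<b lo hi (s≤s k≤f) with v <ᵇ b in v<ᵇb
  ... | true  = ⊥-elim (<⇒≱ (<ᵇ⇒< v b (subst T (sym v<ᵇb) _)) b≤v)
    where b≤v : b ≤ v
          b≤v = ≤-trans (b≤b^k {suc k} (s≤s z≤n)) (≤-trans (m≤n*m (b ^ suc k) d {{>-nonZero 0<d}}) lo)
  ... | false = leadF-digit f 0<d d<b
    (*b≤⇒≤/b (subst (_≤ v) (d*b^[1+k]≡d*b^k*b d k) lo))
    (m<n*o⇒m/o<n (subst (v <_) (d*b^[1+k]≡d*b^k*b (suc d) k) hi)) k≤f

  lead-digit : ∀ k {d v} → 0 < d → d < b → d * b ^ k ≤ v → v < suc d * b ^ k → lead b v ≡ d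
  lead-digit k {d} 0<d d<b lo hi =
    leadF-digit _ 0<d d<b lo hi (≤-trans (<⇒≤ (k<b^k k)) (≤-trans (m≤n*m (b ^ k) d {{>-nonZero 0<d}}) lo))

  IsNextDigit : ℕ → ℕ → Bool
  IsNextDigit a y = eqᵇ (lead b (advance a y)) y

  next≡just : ∀ a {y} → y < b → lead b (advance a y) ≡ y → (∀ z → z < y → lead b (advance a z) ≢ z) →
    next b a ≡ just (advance a y)
  next≡just a y<b ok below
    rewrite firstBelow-just (IsNextDigit a) y<b (eqᵇ-true ok) (λ z z<y → eqᵇ-false (below z z<y)) = refl

  next≡nothing : ∀ a → (∀ y → y < b → lead b (advance a y) ≢ y) → next b a ≡ nothing
  next≡nothing a none rewrite firstBelow-nothing (IsNextDigit a) b (λ y y<b → eqᵇ-false (none y y<b)) = refl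

  next-sound : ∀ a {t} → next b a ≡ just t → ∃ λ y → y < b × lead b t ≡ y × t ≡ advance a y
  next-sound a eq with firstBelow (IsNextDigit a) b in found
  ... | just y with refl ← eq with firstBelow-sound (IsNextDigit a) b found
  ...   | ok , y<b = y , y<b , ≡ᵇ⇒≡ _ _ (subst T (sym ok) _) , refl
  next-sound a () | nothing

  a≤next : ∀ a {t} → next b a ≡ just t → a ≤ t
  a≤next a eq with next-sound a eq
  ... | y , _ , _ , refl = a≤advance a y

  [a+b*x]%b≡a%b : ∀ a x → (a + b * x) % b ≡ a % b
  [a+b*x]%b≡a%b a x rewrite *-comm b x = [m+kn]%n≡m%n a x b

  advance-% : ∀ a y → advance a y % b ≡ (a + y) % b
  advance-% a y = trans (cong (_% b) (swap a (b * (a % b)) y)) ([a+b*x]%b≡a%b (a + y) (a % b))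
    where swap : ∀ a z y → a + z + y ≡ a + y + z
          swap = solve-∀

  -- The predecessor is recovered from t: its lead digit gives y, and t ∸ y determines a mod b, hence a.
  next-injective : ∀ a a' {t} → next b a ≡ just t → next b a' ≡ just t → a ≡ a'
  next-injective a a' eq eq' with next-sound a eq | next-sound a' eq'
  ... | y , _ , ly , t≡ | y' , _ , ly' , t≡' =
    +-cancelʳ-≡ (b * (a % b)) _ _ (trans same (cong (λ z → a' + b * z) (sym a≡a'[b])))
    where
    same : a + b * (a % b) ≡ a' + b * (a' % b)
    same = +-cancelʳ-≡ y _ _ (trans (sym t≡) (trans t≡' (cong (a' + b * (a' % b) +_) (trans (sym ly') ly))))
    a≡a'[b] : a % b ≡ a' % b
    a≡a'[b] = trans (sym ([a+b*x]%b≡a%b a (a % b))) (trans (cong (_% b) same) ([a+b*x]%b≡a%b a' (a' % b)))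

  term-suc : ∀ N n {a} → term b N n ≡ just a → term b N (suc n) ≡ next b a
  term-suc N n eq rewrite eq = refl

  term-pred : ∀ N n {t} → term b N (suc n) ≡ just t → ∃ λ a → term b N n ≡ just a × next b a ≡ just t
  term-pred N n eq with term b N n
  ... | just a = a , refl , eq

  term-bounded-after : ∀ N m {a} top → term b N m ≡ just a → (∀ {t} → next b a ≡ just t → top ≤ t) →
    ∀ j {t} → term b N (suc m + j) ≡ just t → top ≤ t
  term-bounded-after N m top eT bound zero et rewrite +-identityʳ m = bound (trans (sym (term-suc N m eT)) et)
  term-bounded-after N m top eT bound (suc j) et rewrite +-suc m j with term-pred N (suc m + j) et
  ... | a , ea , na = ≤-trans (term-bounded-after N m top eT bound j ea) (a≤next a na)

  term-merge : ∀ {N₁ N₂} n₁ n₂ {t} → term b N₁ n₁ ≡ just t → term b N₂ n₂ ≡ just t →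
    (∃ λ m → term b N₁ m ≡ just N₂) ⊎ (∃ λ m → term b N₂ m ≡ just N₁)
  term-merge zero     n₂       refl e₂   = inj₂ (n₂ , e₂)
  term-merge (suc n₁) zero     e₁   refl = inj₁ (suc n₁ , e₁)
  term-merge {N₁} {N₂} (suc n₁) (suc n₂) e₁ e₂ with term-pred N₁ n₁ e₁ | term-pred N₂ n₂ e₂
  ... | a₁ , f₁ , g₁ | a₂ , f₂ , g₂ rewrite next-injective a₁ a₂ g₁ g₂ = term-merge n₁ n₂ f₁ f₂

  term-terminated : ∀ N n {t} → next b N ≡ nothing → term b N n ≡ just t → t ≡ N
  term-terminated N zero    stop refl = refl
  term-terminated N (suc n) stop et with term-pred N n et
  ... | a , ea , na with term-terminated N n stop ea
  ...   | refl with () ← trans (sym stop) na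

  lastIn-unique : ∀ {N lo hi t₁ t₂} → LastIn b N lo hi t₁ → LastIn b N lo hi t₂ → t₁ ≡ t₂
  lastIn-unique (n₁ , e₁ , l₁ , h₁ , later₁) (n₂ , e₂ , l₂ , h₂ , later₂) with <-cmp n₁ n₂
  ... | tri< n₁<n₂ _ _ = ⊥-elim (later₁ n₂ _ n₁<n₂ e₂ (l₂ , h₂))
  ... | tri≈ _ refl _  = just-injective (trans (sym e₁) e₂)
  ... | tri> _ _ n₂<n₁ = ⊥-elim (later₂ n₁ _ n₂<n₁ e₁ (l₁ , h₁))

  module Block {d} (0<d : 0 < d) (d<b : d < b) (k : ℕ) where

    next-inBlock : ∀ a → d * b ^ k ≤ a → advance a d < suc d * b ^ k → next b a ≡ just (advance a d)
    next-inBlock a lo hi = next≡just a d<b (lead-digit k 0<d d<b (≤-trans lo (a≤advance a d)) hi)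
      λ z z<d eq → <⇒≢ z<d (trans (sym eq)
        (lead-digit k 0<d d<b (≤-trans lo (a≤advance a z)) (≤-<-trans (advance-mono a (<⇒≤ z<d)) hi)))

    -- A smaller digit y < d would need lead digit y, but advance a y still lies in the block.
    next-leavesBlock : ∀ a {t} → d * b ^ k ≤ a → suc d * b ^ k ≤ advance a d → next b a ≡ just t →
      suc d * b ^ k ≤ t
    next-leavesBlock a lo hi eq with next-sound a eq
    ... | y , y<b , ly , refl with suc d * b ^ k ≤? advance a y
    ...   | yes top≤ = top≤
    ...   | no  top≰ =
      ⊥-elim (<⇒≢ y<d (trans (sym ly) (lead-digit k 0<d d<b (≤-trans lo (a≤advance a y)) (≰⇒> top≰))))
      where
      y<d : y < d
      y<d = ≰⇒> λ d≤y → top≰ (≤-trans hi (advance-mono a d≤y))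

  advance-translate : ∀ a y {D} → b ∣ D → advance (a + D) y ≡ advance a y + D
  advance-translate a y {D} b∣D rewrite %-remove-+ʳ a b∣D = swap a D (b * (a % b)) y
    where swap : ∀ a D x y → a + D + x + y ≡ a + x + y + D
          swap = solve-∀

  module Walk (d : ℕ) (0<d : 0 < d) where

    instance
      gcd≢0 : NonZero (gcd b d)
      gcd≢0 = ≢-nonZero (gcd[m,n]≢0 b d (inj₁ (≢-nonZero⁻¹ b)))

    a<advance : ∀ a → a < advance a d
    a<advance a = <-≤-trans (m<m+n a 0<d) (+-monoˡ-≤ d (m≤m+n a (b * (a % b))))

    walk : (top fuel a : ℕ) → ℕ
    walk top zero       a = a
    walk top (suc fuel) a with advance a d <? top
    ... | yes _ = walk top fuel (advance a d)
    ... | no  _ = a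

    walk-stop : ∀ top fuel a → top ≤ a → walk top fuel a ≡ a
    walk-stop top zero       a top≤a = refl
    walk-stop top (suc fuel) a top≤a with advance a d <? top
    ... | yes adv<top = ⊥-elim (<⇒≱ adv<top (≤-trans top≤a (<⇒≤ (a<advance a))))
    ... | no  _       = refl

    walk-fuel : ∀ top f f' a → top ∸ a ≤ f → top ∸ a ≤ f' → walk top f a ≡ walk top f' a
    walk-fuel top zero    f'       a h h' = sym (walk-stop top f' a (m∸n≡0⇒m≤n (n≤0⇒n≡0 h)))
    walk-fuel top (suc f) zero     a h h' = walk-stop top (suc f) a (m∸n≡0⇒m≤n (n≤0⇒n≡0 h'))
    walk-fuel top (suc f) (suc f') a h h' with advance a d <? top
    ... | yes adv<top =
      walk-fuel top f f' (advance a d) (m<1+n⇒m≤n (<-≤-trans shrinks h)) (m<1+n⇒m≤n (<-≤-trans shrinks h'))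
      where shrinks : top ∸ advance a d < top ∸ a
            shrinks = ∸-monoʳ-< (a<advance a) (<⇒≤ adv<top)
    ... | no  _ = refl

    walk-spec : ∀ top f a → top ∸ a ≤ f → a < top →
      walk top f a < top × top ≤ advance (walk top f a) d × a ≤ walk top f a
    walk-spec top zero    a h a<top = ⊥-elim (<⇒≱ (m<n⇒0<n∸m a<top) h)
    walk-spec top (suc f) a h a<top with advance a d <? top
    ... | yes adv<top
      with walk-spec top f (advance a d) (m<1+n⇒m≤n (<-≤-trans (∸-monoʳ-< (a<advance a) (<⇒≤ adv<top)) h)) adv<top
    ...   | below , exits , a≤ = below , exits , ≤-trans (<⇒≤ (a<advance a)) a≤
    walk-spec top (suc f) a h a<top | no adv≮top = a<top , ≮⇒≥ adv≮top , ≤-refl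

    walk-translate : ∀ top f a {D} → b ∣ D → walk (top + D) f (a + D) ≡ walk top f a + D
    walk-translate top zero    a b∣D = refl
    walk-translate top (suc f) a {D} b∣D with advance (a + D) d <? top + D | advance a d <? top
    ... | yes _ | yes _ =
      trans (cong (walk (top + D) f) (advance-translate a d b∣D)) (walk-translate top f (advance a d) b∣D)
    ... | yes p | no ¬q = ⊥-elim (¬q (+-cancelʳ-< D _ _ (subst (_< top + D) (advance-translate a d b∣D) p)))
    ... | no ¬p | yes q = ⊥-elim (¬p (subst (_< top + D) (sym (advance-translate a d b∣D)) (+-monoˡ-< D q)))
    ... | no _  | no _  = refl

    -- Fuel top suffices because every step of the walk increases a.
    lastBelow : ℕ → ℕ → ℕ
    lastBelow top a = walk top top a

    lastBelow-spec : ∀ top a → a < top →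
      lastBelow top a < top × top ≤ advance (lastBelow top a) d × a ≤ lastBelow top a
    lastBelow-spec top a = walk-spec top top a (m∸n≤m top a)

    lastBelow-step : ∀ top a → advance a d < top → lastBelow top a ≡ lastBelow top (advance a d)
    lastBelow-step (suc t) a adv<top with advance a d <? suc t
    ... | yes _ = walk-fuel (suc t) t (suc t) (advance a d)
                    (m<1+n⇒m≤n (∸-monoʳ-< {o = 0} (≤-<-trans z≤n (a<advance a)) (<⇒≤ adv<top)))
                    (m∸n≤m (suc t) (advance a d))
    ... | no ¬adv<top = ⊥-elim (¬adv<top adv<top)

    lastBelow-translate : ∀ top a {D} → b ∣ D → lastBelow (top + D) (a + D) ≡ lastBelow top a + D
    lastBelow-translate top a {D} b∣D = trans
      (walk-fuel (top + D) (top + D) top (a + D) (m∸n≤m (top + D) (a + D))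
        (subst (_≤ top) (sym ([m+o]∸[n+o]≡m∸n top D a)) (m∸n≤m top a)))
      (walk-translate top top a b∣D)

    orbit : ℕ → ℕ → ℕ
    orbit zero    a = a
    orbit (suc i) a = advance (orbit i a) d

    lastBelow-orbit : ∀ top i a → orbit i a < top → lastBelow top a ≡ lastBelow top (orbit i a)
    lastBelow-orbit top zero    a _ = refl
    lastBelow-orbit top (suc i) a below = trans (lastBelow-orbit top i a (<-trans (a<advance (orbit i a)) below))
                                                (lastBelow-step top (orbit i a) below)

    walk-isTerm : ∀ {k} → d < b → ∀ f N m {a} → term b N m ≡ just a → d * b ^ k ≤ a →
      ∃ λ m' → term b N m' ≡ just (walk (suc d * b ^ k) f a)
    walk-isTerm     d<b zero    N m ea lo = m , ea
    walk-isTerm {k} d<b (suc f) N m {a} ea lo with advance a d <? suc d * b ^ k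
    ... | yes adv<top = walk-isTerm {k} d<b f N (suc m)
            (trans (term-suc N m ea) (Block.next-inBlock 0<d d<b k a lo adv<top)) (≤-trans lo (<⇒≤ (a<advance a)))
    ... | no  _       = m , ea

    advance<+b^2 : d < b → ∀ x → advance x d < x + b ^ 2
    advance<+b^2 d<b x = begin-strict
      x + b * (x % b) + d   ≡⟨ +-assoc x _ d ⟩
      x + (b * (x % b) + d) <⟨ +-monoʳ-< x (+-monoʳ-< (b * (x % b)) d<b) ⟩
      x + (b * (x % b) + b) ≡⟨ cong (x +_) (trans (+-comm _ b) (sym (*-suc b (x % b)))) ⟩
      x + b * suc (x % b)   ≤⟨ +-monoʳ-≤ x (*-monoʳ-≤ b (m%n<n x b)) ⟩
      x + b * b             ≡⟨ cong (λ z → x + b * z) (*-identityʳ b) ⟨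
      x + b ^ 2             ∎
      where open ≤-Reasoning

    -- Once a comma sequence is in the block of digit d it moves by a ↦ advance a d until it leaves.
    lastBelow-isLastIn : ∀ {k} → d < b → ∀ N m {a} → term b N m ≡ just a → d * b ^ k ≤ a → a < suc d * b ^ k →
      LastIn b N (suc d * b ^ k ∸ b ^ 2) (suc d * b ^ k) (lastBelow (suc d * b ^ k) a)
    lastBelow-isLastIn {k} d<b N m {a} ea lo a<top
      with walk-isTerm {k} d<b (suc d * b ^ k) N m ea lo | lastBelow-spec (suc d * b ^ k) a a<top
    ... | m' , eT | ℓ<top , top≤adv , a≤ℓ = m' , eT , lo≤ℓ , ℓ<top , later
      where
      top ℓ : ℕ
      top = suc d * b ^ k
      ℓ = lastBelow top a
      lo≤ℓ : top ∸ b ^ 2 ≤ ℓ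
      lo≤ℓ = m≤n+o⇒m∸n≤o top (b ^ 2)
        (≤-trans top≤adv (≤-trans (<⇒≤ (advance<+b^2 d<b ℓ)) (≤-reflexive (+-comm ℓ (b ^ 2)))))
      later : ∀ m'' t → m' < m'' → term b N m'' ≡ just t → ¬ (top ∸ b ^ 2 ≤ t × t < top)
      later m'' t m'<m'' et (_ , t<top) = <⇒≱ t<top
        (term-bounded-after N m' top eT (Block.next-leavesBlock 0<d d<b k ℓ (≤-trans lo a≤ℓ) top≤adv) (m'' ∸ suc m')
          (subst (λ z → term b N z ≡ just t) (sym (m+[n∸m]≡n m'<m'')) et))

    increment : ℕ → ℕ → ℕ
    increment x j = b * ((x + j * d) % b) + d

    orbit-% : ∀ j x → orbit j x % b ≡ (x + j * d) % b
    orbit-% zero    x = cong (_% b) (sym (+-identityʳ x))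
    orbit-% (suc j) x = begin
      advance (orbit j x) d % b    ≡⟨ advance-% (orbit j x) d ⟩
      (orbit j x + d) % b          ≡⟨ [m%n+o]%n≡[m+o]%n (orbit j x) d ⟨
      (orbit j x % b + d) % b      ≡⟨ cong (λ z → (z + d) % b) (orbit-% j x) ⟩
      ((x + j * d) % b + d) % b    ≡⟨ [m%n+o]%n≡[m+o]%n (x + j * d) d ⟩
      (x + j * d + d) % b          ≡⟨ cong (_% b) (assoc x j d) ⟩
      (x + suc j * d) % b          ∎
      where open ≡-Reasoning
            assoc : ∀ x j d → x + j * d + d ≡ x + (1 + j) * d
            assoc = solve-∀

    orbit≡+sum : ∀ i x → orbit i x ≡ x + sumBelow (increment x) i
    orbit≡+sum zero    x = sym (+-identityʳ x)
    orbit≡+sum (suc i) x = begin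
      orbit i x + b * (orbit i x % b) + d       ≡⟨ cong (λ z → orbit i x + b * z + d) (orbit-% i x) ⟩
      orbit i x + b * ((x + i * d) % b) + d     ≡⟨ +-assoc (orbit i x) _ d ⟩
      orbit i x + increment x i                 ≡⟨ cong (_+ increment x i) (orbit≡+sum i x) ⟩
      x + sumBelow (increment x) i + increment x i ≡⟨ +-assoc x _ _ ⟩
      x + sumBelow (increment x) (suc i)        ∎
      where open ≡-Reasoning

    -- After b / gcd b d steps the residue x + j * d mod b returns to its start, and no earlier.
    cycleLength : ℕ
    cycleLength = b / gcd b d

    cycleSum : ℕ → ℕ
    cycleSum x = sumBelow (increment x) cycleLength

    orbit-cycle : ∀ x → orbit cycleLength x ≡ x + cycleSum x
    orbit-cycle = orbit≡+sum cycleLength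

    b∣cycleLength*d : b ∣ cycleLength * d
    b∣cycleLength*d = divides (d / gcd b d) (begin
      cycleLength * d                           ≡⟨ cong (cycleLength *_) (m/n*n≡m (gcd[m,n]∣n b d)) ⟨
      cycleLength * (d / gcd b d * gcd b d)     ≡⟨ rearrange cycleLength (d / gcd b d) (gcd b d) ⟩
      d / gcd b d * (cycleLength * gcd b d)     ≡⟨ cong (d / gcd b d *_) (m/n*n≡m (gcd[m,n]∣m b d)) ⟩
      d / gcd b d * b                           ∎)
      where open ≡-Reasoning
            rearrange : ∀ c d' g → c * (d' * g) ≡ d' * (c * g)
            rearrange = solve-∀

    0<cycleLength : 0 < cycleLength
    0<cycleLength = m≥n⇒m/n>0 (∣⇒≤ (gcd[m,n]∣m b d))

    -- b ∣ t * d forces (b / g) ∣ t * (d / g) with coprime factors, so b / g divides t.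
    cycleLength-minimal : ∀ t → 0 < t → b ∣ t * d → cycleLength ≤ t
    cycleLength-minimal t 0<t b∣td = ∣⇒≤ {{>-nonZero 0<t}}
      (coprime-divisor (coprime-/gcd b d) (*-cancelˡ-∣ (gcd b d) (subst₂ _∣_ (trans (sym (m/n*n≡m (gcd[m,n]∣m b d))) (*-comm cycleLength (gcd b d)))
                  (trans (cong (t *_) (sym (m/n*n≡m (gcd[m,n]∣n b d)))) (rearrange t (d / gcd b d) (gcd b d)))
                  b∣td)))
      where rearrange : ∀ t d' g → t * (d' * g) ≡ g * (d' * t)
            rearrange = solve-∀

    residues-distinct : ∀ x {i j} → i < j → j < cycleLength → (x + i * d) % b ≢ (x + j * d) % b
    residues-distinct x {i} {j} i<j j<c eq = <⇒≱ (≤-<-trans (m∸n≤m j i) j<c)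
      (cycleLength-minimal (j ∸ i) (m<n⇒0<n∸m i<j) ([m+n]%o≡m%o⇒o∣n (x + i * d) ((j ∸ i) * d)
        (trans (cong (_% b) shift) (sym eq))))
      where
      shift : x + i * d + (j ∸ i) * d ≡ x + j * d
      shift = trans (+-assoc x (i * d) _)
        (cong (x +_) (trans (sym (*-distribʳ-+ d i (j ∸ i))) (cong (_* d) (m+[n∸m]≡n (<⇒≤ i<j)))))

    increment-% : ∀ {x y} → x % b ≡ y % b → ∀ j → increment x j ≡ increment y j
    increment-% {x} {y} eq j = cong (λ z → b * z + d)
      (trans (sym ([m%n+o]%n≡[m+o]%n x (j * d)))
        (trans (cong (λ z → (z + j * d) % b) eq) ([m%n+o]%n≡[m+o]%n y (j * d))))

    -- Starting one step later permutes the cycle cyclically, because cycleLength * d ≡ 0 mod b.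
    cycleSum-advance : ∀ {x e} → e % b ≡ (x + d) % b → cycleSum e ≡ cycleSum x
    cycleSum-advance {x} {e} eq = begin
      sumBelow (increment e) cycleLength         ≡⟨ sumBelow-cong cycleLength (λ j → trans (increment-% eq j)
                                                      (cong (λ z → b * (z % b) + d) (assoc x d j))) ⟩
      sumBelow (increment x ∘ suc) cycleLength   ≡⟨ +-cancelʳ-≡ (increment x 0) _ _
                                                      (trans (sumBelow-shift (increment x) cycleLength)
                                                             (cong (sumBelow (increment x) cycleLength +_) wraps)) ⟩
      sumBelow (increment x) cycleLength         ∎
      where
      open ≡-Reasoning
      assoc : ∀ x d j → x + d + j * d ≡ x + (1 + j) * d
      assoc = solve-∀
      wraps : increment x cycleLength ≡ increment x 0
      wraps = cong (λ z → b * z + d) (trans (%-remove-+ʳ x b∣cycleLength*d) (cong (_% b) (sym (+-identityʳ x))))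

    b∣cycleSum : ∀ x → b ∣ cycleSum x
    b∣cycleSum x = subst (b ∣_) (sym (sumBelow-affine b d (λ j → (x + j * d) % b) cycleLength))
      (∣m∣n⇒∣m+n (m∣m*n _) b∣cycleLength*d)

    0<cycleSum : ∀ x → 0 < cycleSum x
    0<cycleSum x with cycleLength | 0<cycleLength
    ... | suc n | _ = <-≤-trans 0<d (≤-trans (m≤n+m d (b * ((x + n * d) % b))) (m≤n+m _ (sumBelow (increment x) n)))

    instance
      cycleSum≢0 : ∀ {x} → NonZero (cycleSum x)
      cycleSum≢0 {x} = >-nonZero (0<cycleSum x)

    -- For a vertex entering its block at offset e, gap e (b ^ k) is the u' of its out-edge.
    gap : ℕ → ℕ → ℕ
    gap e R = R ∸ lastBelow R e

    gap-+*cycleSum : ∀ {e R} → e < R → ∀ q → gap e (R + q * cycleSum e) ≡ gap e R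
    gap-+*cycleSum {e} {R} e<R zero    = cong (gap e) (+-identityʳ R)
    gap-+*cycleSum {e} {R} e<R (suc q) = begin
      gap e (R + (C + q * C))        ≡⟨ cong (gap e) (assoc R C (q * C)) ⟩
      gap e (R' + C)                 ≡⟨ cong ((R' + C) ∸_) lastBelow-+C ⟩
      (R' + C) ∸ (lastBelow R' e + C) ≡⟨ [m+o]∸[n+o]≡m∸n R' C (lastBelow R' e) ⟩
      gap e R'                       ≡⟨ gap-+*cycleSum e<R q ⟩
      gap e R                        ∎
      where
      open ≡-Reasoning
      C R' : ℕ
      C = cycleSum e
      R' = R + q * C
      assoc : ∀ R C x → R + (C + x) ≡ R + x + C
      assoc = solve-∀
      e<R' : e < R'
      e<R' = <-≤-trans e<R (m≤m+n R (q * C))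
      lastBelow-+C : lastBelow (R' + C) e ≡ lastBelow R' e + C
      lastBelow-+C = begin
        lastBelow (R' + C) e                ≡⟨ lastBelow-orbit (R' + C) cycleLength e
                                                 (subst (_< R' + C) (sym (orbit-cycle e)) (+-monoˡ-< C e<R')) ⟩
        lastBelow (R' + C) (orbit cycleLength e) ≡⟨ cong (lastBelow (R' + C)) (orbit-cycle e) ⟩
        lastBelow (R' + C) (e + C)          ≡⟨ lastBelow-translate R' e (b∣cycleSum e) ⟩
        lastBelow R' e + C                  ∎

    gap-% : ∀ {e R R'} → e < R → e < R' → R % cycleSum e ≡ R' % cycleSum e → gap e R ≡ gap e R'
    gap-% {e} {R} {R'} e<R e<R' eq with ≤-total R R'
    ... | inj₁ R≤R' with q , refl ← Residues.%≡⇒+* (cycleSum e) eq R≤R' = sym (gap-+*cycleSum e<R q)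
    ... | inj₂ R'≤R with q , refl ← Residues.%≡⇒+* (cycleSum e) (sym eq) R'≤R = gap-+*cycleSum e<R' q

    -- The m-th element of S_b(d,u) is the m-th increment of the cycle through any x ≡ -u (mod b).
    Sig≡cycleSum : ∀ {u x} → (x + u) % b ≡ 0 → Sig b d u ≡ cycleSum x
    Sig≡cycleSum {u} {x} x+u≡0 = begin
      Sig b d u                                             ≡⟨ cong (sum ∘ deduplicate _≟_) (map-upTo element cycleLength) ⟩
      sum (deduplicate _≟_ (applyUpTo element cycleLength)) ≡⟨ cong sum (deduplicate-distinct _ distinct) ⟩
      sum (applyUpTo element cycleLength)                   ≡⟨ sum-applyUpTo element cycleLength ⟩
      sumBelow element cycleLength                          ≡⟨ sumBelow-cong cycleLength element≡increment ⟩
      cycleSum x                                            ∎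
      where
      open ≡-Reasoning
      element : ℕ → ℕ
      element m = ((ℤ.+ (m * d) ℤ.- ℤ.+ u) %ℕ b) * b + d
      residue : ∀ m → (x + m * d) % b ≡ (ℤ.+ (m * d) ℤ.- ℤ.+ u) %ℕ b
      residue m = begin
        (x + m * d) % b             ≡⟨ [m+o%n]%n≡[m+o]%n x (m * d) ⟨
        (x + m * d % b) % b         ≡⟨ cong (λ z → (x + z) % b) ([[a-u]%ℕm+u]%m≡a%m (m * d) u) ⟨
        (x + (ρ + u) % b) % b       ≡⟨ [m+o%n]%n≡[m+o]%n x (ρ + u) ⟩
        (x + (ρ + u)) % b           ≡⟨ cong (_% b) (rearrange x ρ u) ⟩
        (ρ + (x + u)) % b           ≡⟨ [m+o%n]%n≡[m+o]%n ρ (x + u) ⟨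
        (ρ + (x + u) % b) % b       ≡⟨ cong (λ z → (ρ + z) % b) x+u≡0 ⟩
        (ρ + 0) % b                 ≡⟨ cong (_% b) (+-identityʳ ρ) ⟩
        ρ % b                       ≡⟨ m<n⇒m%n≡m (n%ℕd<d (ℤ.+ (m * d) ℤ.- ℤ.+ u) b) ⟩
        ρ                           ∎
        where ρ : ℕ
              ρ = (ℤ.+ (m * d) ℤ.- ℤ.+ u) %ℕ b
              rearrange : ∀ x r u → x + (r + u) ≡ r + (x + u)
              rearrange = solve-∀
      element≡increment : ∀ m → element m ≡ increment x m
      element≡increment m = cong (_+ d) (trans (*-comm _ b) (cong (b *_) (sym (residue m))))
      distinct : AllPairs _≢_ (applyUpTo element cycleLength)
      distinct = AllPairs.applyUpTo⁺₁ element cycleLength λ {i} {j} i<j j<c eq → residues-distinct x i<j j<c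
        (*-cancelˡ-≡ _ _ b (+-cancelʳ-≡ d _ _ (trans (sym (element≡increment i)) (trans eq (element≡increment j)))))

  -- The lead digit just below d * b ^ k, borrowing from the next place when d = 1.
  digitBelow : ℕ → ℕ
  digitBelow (suc zero) = b ∸ 1
  digitBelow d          = d ∸ 1

  lead-belowTop : ∀ j {δ v} → 0 < δ → δ < b → 1 ≤ j → v < suc δ * b ^ j → suc δ * b ^ j ≤ v + b →
    lead b v ≡ δ
  lead-belowTop j {δ} {v} 0<δ δ<b 1≤j hi lo = lead-digit j 0<δ δ<b
    (+-cancelʳ-≤ b (δ * b ^ j) v (≤-trans (+-monoʳ-≤ (δ * b ^ j) (b≤b^k 1≤j))
      (subst (_≤ v + b) (+-comm (b ^ j) (δ * b ^ j)) lo))) hi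

  lead-justBelow : ∀ k {d v} → 2 ≤ k → 0 < d → d < b → v < d * b ^ k → d * b ^ k ≤ v + b →
    lead b v ≡ digitBelow d
  lead-justBelow (suc (suc j)) {suc zero} {v} 2≤k 0<d d<b hi lo =
    lead-belowTop (suc j) (m<n⇒0<n∸m 1<b) (∸-monoʳ-< {o = 0} z<s (<⇒≤ 1<b)) (s≤s z≤n)
      (subst (v <_) b^k≡ hi) (subst (_≤ v + b) b^k≡ lo)
    where b^k≡ : 1 * b ^ suc (suc j) ≡ suc (b ∸ 1) * b ^ suc j
          b^k≡ = trans (*-identityˡ _) (cong (_* b ^ suc j) (sym 1+[b∸1]≡b))
  lead-justBelow (suc zero) {suc zero} (s≤s ()) 0<d d<b hi lo
  lead-justBelow k {suc (suc δ)} 2≤k 0<d d<b hi lo =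
    lead-belowTop k z<s (<-trans (n<1+n (suc δ)) d<b) (≤-trans (s≤s z≤n) 2≤k) hi lo

  digits<b^2 : ∀ {r s} → r < b → s < b → r * b + s < b ^ 2
  digits<b^2 {r} {s} r<b s<b = begin-strict
    r * b + s  <⟨ +-monoʳ-< (r * b) s<b ⟩
    r * b + b  ≡⟨ +-comm (r * b) b ⟩
    suc r * b  ≤⟨ *-monoˡ-≤ b r<b ⟩
    b * b      ≡⟨ cong (b *_) (*-identityʳ b) ⟨
    b ^ 2      ∎
    where open ≤-Reasoning

  b^2≤d*b^k : ∀ {d k} → 0 < d → 2 ≤ k → b ^ 2 ≤ d * b ^ k
  b^2≤d*b^k {d} {k} 0<d 2≤k = ≤-trans (b^2≤b^k 2≤k) (m≤n*m (b ^ k) d {{>-nonZero 0<d}})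

  b∣d*b^k : ∀ d {k} → 1 ≤ k → b ∣ d * b ^ k
  b∣d*b^k d {suc k} _ = divides (d * b ^ k) (d*b^[1+k]≡d*b^k*b d k)

  entryOffset : ℕ → ℕ → ℕ → ℕ
  entryOffset r s d = (b ∸ (r + s)) * b + d ∸ s

  -- The digit pairs of U(b, d) whose comma sequence continues: all but d = 1, r + s = b, s ≥ 2.
  Lands : ℕ → ℕ → ℕ → Set
  Lands r s d = r + s < b ⊎ (s ≤ d × s ≤ digitBelow d)

  -- Where the comma sequence from d * b ^ k - (r * b + s) first lands, by a uniform computation:
  -- advance N y + s ≡ A + (t * b + y) with t = b - (r + s).
  module Entry {d} (0<d : 0 < d) (d<b : d < b) {r s} (0<s : 0 < s) (s<b : s < b) (r+s≤b : r + s ≤ b)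
               {k} (2≤k : 2 ≤ k) where

    t A u N : ℕ
    t = b ∸ (r + s)
    A = d * b ^ k
    u = r * b + s
    N = A ∸ u

    r+t+s≡b : r + t + s ≡ b
    r+t+s≡b = trans (swap r t s) (m+[n∸m]≡n r+s≤b)
      where swap : ∀ r t s → r + t + s ≡ r + s + t
            swap = solve-∀

    t<b : t < b
    t<b = ∸-monoʳ-< {o = 0} (≤-trans 0<s (m≤n+m s r)) r+s≤b

    tb+y<b^2 : ∀ {y} → y < b → t * b + y < b ^ 2
    tb+y<b^2 y<b = digits<b^2 t<b y<b

    u≤A : u ≤ A
    u≤A = ≤-trans (<⇒≤ (digits<b^2 (<-≤-trans (m<m+n r 0<s) r+s≤b) s<b)) (b^2≤d*b^k 0<d 2≤k)

    N+u≡A : N + u ≡ A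
    N+u≡A = m∸n+n≡m u≤A

    N%b≡r+t : N % b ≡ r + t
    N%b≡r+t = trans (%-cancelʳ-+ N (r + t) s (trans N+s≡0 (sym r+t+s≡0))) (m<n⇒m%n≡m r+t<b)
      where
      r+t<b : r + t < b
      r+t<b = subst (r + t <_) r+t+s≡b (m<m+n (r + t) 0<s)
      r+t+s≡0 : (r + t + s) % b ≡ 0
      r+t+s≡0 = trans (cong (_% b) r+t+s≡b) (n%n≡0 b)
      N+s≡0 : (N + s) % b ≡ 0
      N+s≡0 = begin
        (N + s) % b           ≡⟨ [a+b*x]%b≡a%b (N + s) r ⟨
        (N + s + b * r) % b   ≡⟨ cong (_% b) (trans (rearrange N s b r) N+u≡A) ⟩
        A % b                 ≡⟨ n∣m⇒m%n≡0 A b (b∣d*b^k d (≤-trans (s≤s z≤n) 2≤k)) ⟩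
        0                     ∎
        where open ≡-Reasoning
              rearrange : ∀ N s b r → N + s + b * r ≡ N + (r * b + s)
              rearrange = solve-∀

    advance+s : ∀ y → advance N y + s ≡ A + (t * b + y)
    advance+s y = begin
      N + b * (N % b) + y + s          ≡⟨ cong (λ z → N + b * z + y + s) N%b≡r+t ⟩
      N + b * (r + t) + y + s          ≡⟨ rearrange N b r t y s ⟩
      N + (r * b + s) + (t * b + y)    ≡⟨ cong (_+ (t * b + y)) N+u≡A ⟩
      A + (t * b + y)                  ∎
      where open ≡-Reasoning
            rearrange : ∀ N b r t y s → N + b * (r + t) + y + s ≡ N + (r * b + s) + (t * b + y)
            rearrange = solve-∀

    advance≡A+ : ∀ {y} → s ≤ t * b + y → advance N y ≡ A + (t * b + y ∸ s)
    advance≡A+ {y} s≤ = +-cancelʳ-≡ s _ _ (trans (advance+s y)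
      (trans (cong (A +_) (sym (m∸n+n≡m s≤))) (sym (+-assoc A _ s))))

    lead-advance-high : ∀ {y} → y < b → s ≤ t * b + y → lead b (advance N y) ≡ d
    lead-advance-high {y} y<b s≤ rewrite advance≡A+ s≤ = lead-digit k 0<d d<b (m≤m+n A _)
      (subst (A + (t * b + y ∸ s) <_) (+-comm A (b ^ k))
        (+-monoʳ-< A (≤-<-trans (m∸n≤m (t * b + y) s) (<-≤-trans (tb+y<b^2 y<b) (b^2≤b^k 2≤k)))))

    lead-advance-low : ∀ {y} → t * b + y < s → lead b (advance N y) ≡ digitBelow d
    lead-advance-low {y} <s = lead-justBelow k 2≤k 0<d d<b
      (subst (advance N y <_) reaches (m<m+n _ (m<n⇒0<n∸m <s)))
      (subst (_≤ advance N y + b) reaches (+-monoʳ-≤ (advance N y) (≤-trans (m∸n≤m s (t * b + y)) (<⇒≤ s<b))))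
      where
      reaches : advance N y + (s ∸ (t * b + y)) ≡ A
      reaches = +-cancelʳ-≡ (t * b + y) _ _ (trans (+-assoc (advance N y) _ _)
        (trans (cong (advance N y +_) (m∸n+n≡m (<⇒≤ <s))) (advance+s y)))

    entryOffset<b^2 : entryOffset r s d < b ^ 2
    entryOffset<b^2 = ≤-<-trans (m∸n≤m (t * b + d) s) (tb+y<b^2 d<b)

    b≤t*b : r + s < b → b ≤ t * b
    b≤t*b r+s<b = m≤n*m b t {{>-nonZero (m<n⇒0<n∸m r+s<b)}}

    Lands⇒s≤tb+d : Lands r s d → s ≤ t * b + d
    Lands⇒s≤tb+d (inj₁ r+s<b)     = ≤-trans (<⇒≤ s<b) (≤-trans (b≤t*b r+s<b) (m≤m+n (t * b) d))
    Lands⇒s≤tb+d (inj₂ (s≤d , _)) = ≤-trans s≤d (m≤n+m d (t * b))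

    -- In the second case, when t * b + z < s the lead digit is digitBelow d ≥ s > z.
    lead-advance≢ : Lands r s d → ∀ z → z < d → lead b (advance N z) ≢ z
    lead-advance≢ lands z z<d with s ≤? t * b + z | lands
    ... | yes s≤ | _ = λ eq → <⇒≢ z<d (trans (sym eq) (lead-advance-high (<-trans z<d d<b) s≤))
    ... | no  s≰ | inj₁ r+s<b = ⊥-elim (s≰ (≤-trans (<⇒≤ s<b) (≤-trans (b≤t*b r+s<b) (m≤m+n (t * b) z))))
    ... | no  s≰ | inj₂ (_ , s≤below) = λ eq → <-irrefl refl (<-≤-trans (≤-<-trans (m≤n+m z (t * b)) (≰⇒> s≰))
                                  (subst (s ≤_) (trans (sym (lead-advance-low (≰⇒> s≰))) eq) s≤below))

    next-entry : Lands r s d → next b N ≡ just (A + entryOffset r s d)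
    next-entry lands = trans (next≡just N d<b (lead-advance-high d<b (Lands⇒s≤tb+d lands)) (lead-advance≢ lands))
                             (cong just (advance≡A+ (Lands⇒s≤tb+d lands)))

    next-entry-terminates : r + s ≡ b → d ≡ 1 → 2 ≤ s → next b N ≡ nothing
    next-entry-terminates r+s≡b refl 2≤s = next≡nothing N wrong
      where
      t≡0 : t ≡ 0
      t≡0 = trans (cong (b ∸_) r+s≡b) (n∸n≡0 b)
      wrong : ∀ y → y < b → lead b (advance N y) ≢ y
      wrong y y<b with s ≤? t * b + y
      ... | yes s≤ = λ eq → <⇒≢ (<-≤-trans (s≤s (s≤s z≤n)) (≤-trans 2≤s (subst (λ z → s ≤ z * b + y) t≡0 s≤)))
                                  (trans (sym (lead-advance-high y<b s≤)) eq)
      ... | no  s≰ = λ eq → <⇒≢ (<-≤-trans (≤-<-trans (m≤n+m y (t * b)) (≰⇒> s≰)) (s<b⇒s≤b∸1 s<b))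
                                  (trans (sym eq) (lead-advance-low (≰⇒> s≰)))

  EntersAt : ℕ → ℕ → ℕ → Set
  EntersAt d u e = ∀ k → 2 ≤ k → next b (d * b ^ k ∸ u) ≡ just (d * b ^ k + e)

  Terminates : ℕ → ℕ → Set
  Terminates d u = ∀ k → 2 ≤ k → next b (d * b ^ k ∸ u) ≡ nothing

  lands : ∀ {d r s} → 0 < d → d < b → 0 < s → s < b → r + s ≤ b → Lands r s d →
    ∃ λ e → e < b ^ 2 × EntersAt d (r * b + s) e
  lands 0<d d<b 0<s s<b r+s≤b l = _ , Entry.entryOffset<b^2 0<d d<b 0<s s<b r+s≤b ≤-refl ,
    λ k 2≤k → Entry.next-entry 0<d d<b 0<s s<b r+s≤b 2≤k l

  entry : ∀ {d u} → 0 < d → d < b → InU b d u → (∃ λ e → e < b ^ 2 × EntersAt d u e) ⊎ Terminates d u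
  entry {suc zero} 0<d d<b (r , s , r<b , s<b , refl , r+s≤b , 0<s) with r + s <? b | s ≤? 1
  ... | yes r+s<b | _       = inj₁ (lands 0<d d<b 0<s s<b r+s≤b (inj₁ r+s<b))
  ... | no  r+s≮b | yes s≤1 = inj₁ (lands 0<d d<b 0<s s<b r+s≤b (inj₂ (s≤1 , s<b⇒s≤b∸1 s<b)))
  ... | no  r+s≮b | no  s≰1 = inj₂ λ k 2≤k →
    Entry.next-entry-terminates 0<d d<b 0<s s<b r+s≤b 2≤k (≤-antisym r+s≤b (≮⇒≥ r+s≮b)) refl (≰⇒> s≰1)
  entry {suc (suc δ)} 0<d d<b (r , s , r<b , s<b , refl , inj₁ (r+s<b , 0<s)) =
    inj₁ (lands 0<d d<b 0<s s<b (<⇒≤ r+s<b) (inj₁ r+s<b))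
  entry {suc (suc δ)} 0<d d<b (r , s , r<b , s<b , refl , inj₂ (r+s≡b , s<d)) =
    inj₁ (lands 0<d d<b (r+s≡b⇒0<s r<b r+s≡b) s<b (≤-reflexive r+s≡b) (inj₂ (<⇒≤ s<d , m<1+n⇒m≤n s<d)))

  InU⇒<b^2 : ∀ {d u} → InU b d u → u < b ^ 2
  InU⇒<b^2 (r , s , r<b , s<b , refl , _) = digits<b^2 r<b s<b

  InU⇒0<u : ∀ {d u} → InU b d u → 0 < u
  InU⇒0<u {suc zero}    (r , s , _ , _ , refl , _ , 0<s)        = ≤-trans 0<s (m≤n+m s (r * b))
  InU⇒0<u {zero}        (r , s , _ , _ , refl , inj₁ (_ , 0<s)) = ≤-trans 0<s (m≤n+m s (r * b))
  InU⇒0<u {suc (suc _)} (r , s , _ , _ , refl , inj₁ (_ , 0<s)) = ≤-trans 0<s (m≤n+m s (r * b))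
  InU⇒0<u {suc (suc _)} (r , s , r<b , _ , refl , inj₂ (r+s≡b , _)) =
    ≤-trans (r+s≡b⇒0<s r<b r+s≡b) (m≤n+m s (r * b))

<⇒nonZero : ∀ {κ L} → κ < L → NonZero L
<⇒nonZero κ<L = >-nonZero (≤-<-trans z≤n κ<L)

module Classes (L : ℕ) .{{_ : NonZero L}} where

  open Residues L

  InClass⇒% : ∀ {k κ} → InClass L k κ → k % L ≡ κ % L
  InClass⇒% {κ = κ} (q , refl) = [m+kn]%n≡m%n κ q L

  InClass-unique : ∀ {k κ₁ κ₂} → κ₁ < L → κ₂ < L → InClass L k κ₁ → InClass L k κ₂ → κ₁ ≡ κ₂
  InClass-unique κ₁<L κ₂<L c₁ c₂ = <⇒%-injective κ₁<L κ₂<L (trans (sym (InClass⇒% c₁)) (InClass⇒% c₂))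

  InClass-+ : ∀ {k κ} δ → InClass L k κ → InClass L (k + δ) ((κ + δ) % L)
  InClass-+ {κ = κ} δ (q , refl) = (κ + δ) / L + q , (begin
    κ + q * L + δ                         ≡⟨ swap κ (q * L) δ ⟩
    κ + δ + q * L                         ≡⟨ cong (_+ q * L) (m≡m%n+[m/n]*n (κ + δ) L) ⟩
    (κ + δ) % L + (κ + δ) / L * L + q * L ≡⟨ regroup ((κ + δ) % L) ((κ + δ) / L) L q ⟩
    (κ + δ) % L + ((κ + δ) / L + q) * L   ∎)
    where open ≡-Reasoning
          swap : ∀ a b c → a + b + c ≡ a + c + b
          swap = solve-∀
          regroup : ∀ a x L q → a + x * L + q * L ≡ a + (x + q) * L
          regroup = solve-∀

  Q≤κ+Q*L : ∀ κ Q → Q ≤ κ + Q * L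
  Q≤κ+Q*L κ Q = ≤-trans (m≤m*n Q L) (m≤n+m (Q * L) κ)

  InClass-cancel : ∀ {κ κ₁ κ₂} Q c → κ₁ < L → κ₂ < L →
    InClass L (κ₁ + Q * L + c) κ → InClass L (κ₂ + Q * L + c) κ → κ₁ ≡ κ₂
  InClass-cancel {κ₁ = κ₁} {κ₂} Q c κ₁<L κ₂<L cls₁ cls₂ = <⇒%-injective κ₁<L κ₂<L (begin
    κ₁ % L              ≡⟨ [m+kn]%n≡m%n κ₁ Q L ⟨
    (κ₁ + Q * L) % L    ≡⟨ %-cancelʳ-+ (κ₁ + Q * L) (κ₂ + Q * L) c
                             (trans (InClass⇒% cls₁) (sym (InClass⇒% cls₂))) ⟩
    (κ₂ + Q * L) % L    ≡⟨ [m+kn]%n≡m%n κ₂ Q L ⟩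
    κ₂ % L              ∎)
    where open ≡-Reasoning

  InClass-beyond : ∀ {k κ} Q → κ + Q * L ≤ k → InClass L k κ → ∃ λ p → k ≡ κ + Q * L + p * L
  InClass-beyond {κ = κ} Q le (q , refl) = q ∸ Q , (begin
    κ + q * L                   ≡⟨ cong (λ z → κ + z * L) (m+[n∸m]≡n Q≤q) ⟨
    κ + (Q + (q ∸ Q)) * L       ≡⟨ distrib κ Q (q ∸ Q) L ⟩
    κ + Q * L + (q ∸ Q) * L     ∎)
    where
    open ≡-Reasoning
    Q≤q : Q ≤ q
    Q≤q = *-cancelʳ-≤ Q q L (+-cancelˡ-≤ κ _ _ le)
    distrib : ∀ κ a t L → κ + (a + t) * L ≡ κ + a * L + t * L
    distrib = solve-∀

module Digraph (b : ℕ) .{{_ : NonZero b}} (1<b : 1 < b) where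

  open CommaSequence b 1<b

  nextDigit carry : ℕ → ℕ
  nextDigit d = proj₁ (nextDK b d 0)
  carry     d = proj₂ (nextDK b d 0)

  nextDK≡ : ∀ d k → nextDK b d k ≡ (nextDigit d , k + carry d)
  nextDK≡ d k with suc d <ᵇ b
  ... | true  = cong (suc d ,_) (sym (+-identityʳ k))
  ... | false = cong (1 ,_) (+-comm 1 k)

  1+d≡b : ∀ {d} → d < b → (suc d <ᵇ b) ≡ false → suc d ≡ b
  1+d≡b d<b not< = ≤-antisym d<b (≮⇒≥ λ 1+d<b → subst T not< (<⇒<ᵇ 1+d<b))

  nextDigit-top : ∀ {d} k → d < b → nextDigit d * b ^ (k + carry d) ≡ suc d * b ^ k
  nextDigit-top {d} k d<b with suc d <ᵇ b in 1+d<ᵇb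
  ... | true  = cong (λ z → suc d * b ^ z) (+-identityʳ k)
  ... | false = begin
    1 * b ^ (k + 1) ≡⟨ *-identityˡ _ ⟩
    b ^ (k + 1)     ≡⟨ cong (b ^_) (+-comm k 1) ⟩
    b * b ^ k       ≡⟨ cong (_* b ^ k) (1+d≡b d<b 1+d<ᵇb) ⟨
    suc d * b ^ k   ∎
    where open ≡-Reasoning

  nextDigit-injective : ∀ {d₁ d₂} → 0 < d₁ → 0 < d₂ → d₁ < b → d₂ < b →
    nextDigit d₁ ≡ nextDigit d₂ → d₁ ≡ d₂
  nextDigit-injective {d₁} {d₂} 0<d₁ 0<d₂ d₁<b d₂<b eq with suc d₁ <ᵇ b in e₁ | suc d₂ <ᵇ b in e₂
  ... | true  | true  = suc-injective eq
  ... | true  | false = ⊥-elim (<⇒≢ 0<d₁ (sym (suc-injective eq)))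
  ... | false | true  = ⊥-elim (<⇒≢ 0<d₂ (suc-injective eq))
  ... | false | false = suc-injective (trans (1+d≡b d₁<b e₁) (sym (1+d≡b d₂<b e₂)))

  LastGap : ℕ → ℕ → ℕ → ℕ → Set
  LastGap d u k u' = LastIn b (d * b ^ k ∸ u) (suc d * b ^ k ∸ b ^ 2) (suc d * b ^ k) (suc d * b ^ k ∸ u')

  edge-inv : ∀ {d u k d' u' k'} → d < b → Edge b d u k d' u' k' →
    d' ≡ nextDigit d × k' ≡ k + carry d × InU b d' u' × LastGap d u k u'
  edge-inv {d} {u} {k} {u' = u'} d<b (dk , inU , last) with refl ← trans (sym dk) (nextDK≡ d k) =
    refl , refl , inU , subst (λ top → LastIn b (d * b ^ k ∸ u) (top ∸ b ^ 2) top (top ∸ u')) (nextDigit-top k d<b) last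

  edge-intro : ∀ {d u k u'} → d < b → InU b (nextDigit d) u' → LastGap d u k u' →
    Edge b d u k (nextDigit d) u' (k + carry d)
  edge-intro {d} {u} {k} {u'} d<b inU last = nextDK≡ d k , inU ,
    subst (λ top → LastIn b (d * b ^ k ∸ u) (top ∸ b ^ 2) top (top ∸ u')) (sym (nextDigit-top k d<b)) last

  InU⇒≤top : ∀ {d' u'} d {k} → 2 ≤ k → InU b d' u' → u' ≤ suc d * b ^ k
  InU⇒≤top d {k} 2≤k inU = ≤-trans (<⇒≤ (<-≤-trans (InU⇒<b^2 inU) (b^2≤b^k 2≤k))) (m≤m+n (b ^ k) (d * b ^ k))

  LastGap-unique : ∀ {d u k u₁ u₂} → u₁ ≤ suc d * b ^ k → u₂ ≤ suc d * b ^ k →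
    LastGap d u k u₁ → LastGap d u k u₂ → u₁ ≡ u₂
  LastGap-unique u₁≤ u₂≤ last₁ last₂ = ∸-cancelˡ-≡ u₁≤ u₂≤ (lastIn-unique last₁ last₂)

  u≤d*b^k : ∀ {d u k} → 0 < d → 2 ≤ k → InU b d u → u ≤ d * b ^ k
  u≤d*b^k 0<d 2≤k inU = ≤-trans (<⇒≤ (InU⇒<b^2 inU)) (b^2≤d*b^k 0<d 2≤k)

  terminates-noEdge : ∀ {d u k d' u' k'} → 0 < d → d < b → InU b d u → Terminates d u → 2 ≤ k →
    ¬ Edge b d u k d' u' k'
  terminates-noEdge {d} {u} {k} 0<d d<b inU stops 2≤k edge with edge-inv {d} {u} {k} d<b edge
  ... | _ , _ , _ , n , tn , lo≤t , _ = <⇒≱ N<lo (≤-trans lo≤t (≤-reflexive (term-terminated N n (stops k 2≤k) tn)))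
    where
    A N : ℕ
    A = d * b ^ k
    N = A ∸ u
    N<lo : N < suc d * b ^ k ∸ b ^ 2
    N<lo = <-≤-trans (∸-monoʳ-< {o = 0} (InU⇒0<u {d} inU) (u≤d*b^k {d} {u} 0<d 2≤k inU))
      (m+n≤o⇒m≤o∸n A (subst (_≤ b ^ k + A) (+-comm (b ^ 2) A) (+-monoˡ-≤ A (b^2≤b^k 2≤k))))

  -- The first step from d * b ^ k - u already jumps past d * b ^ k.
  term<⇒start : ∀ {d u k m N'} → 0 < d → d < b → InU b d u → 2 ≤ k →
    term b (d * b ^ k ∸ u) m ≡ just N' → N' < d * b ^ k → N' ≡ d * b ^ k ∸ u
  term<⇒start {d} {u} {k} {m} 0<d d<b inU 2≤k tm N'<A with entry {d} {u} 0<d d<b inU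
  ... | inj₂ stops = term-terminated _ m (stops k 2≤k) tm
  ... | inj₁ (e , _ , enters) with m
  ...   | zero    = sym (just-injective tm)
  ...   | suc m'  = ⊥-elim (<⇒≱ N'<A (term-bounded-after _ 0 (d * b ^ k) refl jumps m' tm))
    where jumps : ∀ {t} → next b (d * b ^ k ∸ u) ≡ just t → d * b ^ k ≤ t
          jumps next≡ = ≤-trans (m≤m+n _ e) (≤-reflexive (just-injective (trans (sym (enters k 2≤k)) next≡)))

  source-unique : ∀ {d u₁ u₂ k lo hi t} → 0 < d → d < b → InU b d u₁ → InU b d u₂ → 2 ≤ k →
    LastIn b (d * b ^ k ∸ u₁) lo hi t → LastIn b (d * b ^ k ∸ u₂) lo hi t → u₁ ≡ u₂
  source-unique {d} {u₁} {u₂} {k} 0<d d<b inU₁ inU₂ 2≤k (n₁ , t₁ , _) (n₂ , t₂ , _) =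
    ∸-cancelˡ-≡ (u≤d*b^k {d} {u₁} 0<d 2≤k inU₁) (u≤d*b^k {d} {u₂} 0<d 2≤k inU₂) starts≡
    where
    N<A : ∀ {u} → InU b d u → d * b ^ k ∸ u < d * b ^ k
    N<A {u} inU = ∸-monoʳ-< {o = 0} (InU⇒0<u {d} inU) (u≤d*b^k {d} {u} 0<d 2≤k inU)
    starts≡ : d * b ^ k ∸ u₁ ≡ d * b ^ k ∸ u₂
    starts≡ with term-merge n₁ n₂ t₁ t₂
    ... | inj₁ (m , tm) = sym (term<⇒start {d} {u₁} {k} {m} 0<d d<b inU₁ 2≤k tm (N<A inU₂))
    ... | inj₂ (m , tm) = term<⇒start {d} {u₂} {k} {m} 0<d d<b inU₂ 2≤k tm (N<A inU₁)

  digits-unique : ∀ {r s} → s < b → r ≡ (r * b + s) / b × s ≡ (r * b + s) % b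
  digits-unique {r} {s} s<b = r≡ , s≡
    where
    s≡ : s ≡ (r * b + s) % b
    s≡ = sym (trans (cong (_% b) (+-comm (r * b) s)) (trans ([m+kn]%n≡m%n s r b) (m<n⇒m%n≡m s<b)))
    r≡ : r ≡ (r * b + s) / b
    r≡ = *-cancelʳ-≡ r ((r * b + s) / b) b (+-cancelʳ-≡ s _ _ (trans (m≡m%n+[m/n]*n (r * b + s) b)
           (trans (cong (_+ (r * b + s) / b * b) (sym s≡)) (+-comm s _))))

  -- The only candidate digits (r , s) of u are u / b and u % b.
  digits? : (C : ℕ → ℕ → Set) → (∀ r s → Dec (C r s)) → ∀ u →
    Dec (Σ ℕ λ r → Σ ℕ λ s → r < b × s < b × u ≡ r * b + s × C r s)
  digits? C C? u with u / b <? b | C? (u / b) (u % b)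
  ... | yes r<b | yes c = yes (u / b , u % b , r<b , m%n<n u b , trans (m≡m%n+[m/n]*n u b) (+-comm (u % b) _) , c)
  ... | no  r≮b | _     = no λ { (r , s , r<b , s<b , refl , _) → r≮b (subst (_< b) (proj₁ (digits-unique {r} s<b)) r<b) }
  ... | yes _   | no ¬c = no λ { (r , s , _ , s<b , refl , c) →
    ¬c (subst₂ C (proj₁ (digits-unique {r} s<b)) (proj₂ (digits-unique {r} s<b)) c) }

  InU? : ∀ d u → Dec (InU b d u)
  InU? zero            = digits? _ λ r s → ((r + s <? b) ×-dec (0 <? s)) ⊎-dec ((r + s ≟ b) ×-dec (s <? 0))
  InU? (suc zero)      = digits? _ λ r s → (r + s ≤? b) ×-dec (0 <? s)
  InU? d@(suc (suc _)) = digits? _ λ r s → ((r + s <? b) ×-dec (0 <? s)) ⊎-dec ((r + s ≟ b) ×-dec (s <? d))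

  module Entering {d u e} (0<d : 0 < d) (d<b : d < b) (inU : InU b d u) (e<b^2 : e < b ^ 2) (enters : EntersAt d u e) where

    open Walk d 0<d

    -- The walk inside the block of d is the walk from e translated by d * b ^ k.
    lastGap : ∀ {k} → 2 ≤ k → LastGap d u k (gap e (b ^ k))
    lastGap {k} 2≤k = subst (LastIn b (A ∸ u) (top ∸ b ^ 2) top) lastBelow≡
      (lastBelow-isLastIn {k} d<b (A ∸ u) 1 (enters k 2≤k) (m≤m+n A e) (subst (A + e <_) (+-comm A R) (+-monoʳ-< A e<R)))
      where
      A R top : ℕ
      A = d * b ^ k
      R = b ^ k
      top = suc d * b ^ k
      e<R : e < R
      e<R = <-≤-trans e<b^2 (b^2≤b^k 2≤k)
      lastBelow≡ : lastBelow top (A + e) ≡ top ∸ gap e R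
      lastBelow≡ = begin
        lastBelow (R + A) (A + e)      ≡⟨ cong (lastBelow (R + A)) (+-comm A e) ⟩
        lastBelow (R + A) (e + A)      ≡⟨ lastBelow-translate R e (b∣d*b^k d (≤-trans (s≤s z≤n) 2≤k)) ⟩
        lastBelow R e + A              ≡⟨ [m+n]∸[m∸o]≡o+n A (<⇒≤ (proj₁ (lastBelow-spec R e e<R))) ⟨
        (R + A) ∸ gap e R              ∎
        where open ≡-Reasoning

    edge⇒ : ∀ {k d' u' k'} → 2 ≤ k → Edge b d u k d' u' k' →
      d' ≡ nextDigit d × k' ≡ k + carry d × u' ≡ gap e (b ^ k)
    edge⇒ {k} 2≤k edge with edge-inv {d} {u} {k} d<b edge
    ... | d'≡ , k'≡ , inU' , last = d'≡ , k'≡ ,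
      LastGap-unique {d} {u} {k} (InU⇒≤top d 2≤k inU') gap≤top last (lastGap 2≤k)
      where gap≤top : gap e (b ^ k) ≤ suc d * b ^ k
            gap≤top = ≤-trans (m∸n≤m (b ^ k) (lastBelow (b ^ k) e)) (m≤m+n (b ^ k) (d * b ^ k))

    A₂ N₂ : ℕ
    A₂ = d * b ^ 2
    N₂ = A₂ ∸ u

    b∣A₂ : b ∣ A₂
    b∣A₂ = b∣d*b^k d {2} (s≤s z≤n)

    -- Both e and N₂ lie on one cycle: e ≡ N₂ + d and N₂ ≡ -u (mod b).
    Sig≡cycleSum-entry : Sig b d u ≡ cycleSum e
    Sig≡cycleSum-entry with next-sound N₂ (enters 2 ≤-refl)
    ... | y , _ , lead≡y , A₂+e≡ with trans (sym lead≡y) (lead-digit 2 0<d d<b (m≤m+n A₂ e)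
                                           (subst (A₂ + e <_) (+-comm A₂ (b ^ 2)) (+-monoʳ-< A₂ e<b^2)))
    ...   | refl = trans (Sig≡cycleSum N₂+u≡0) (sym (cycleSum-advance e≡N₂+d))
      where
      N₂+u≡0 : (N₂ + u) % b ≡ 0
      N₂+u≡0 = trans (cong (_% b) (m∸n+n≡m (u≤d*b^k {d} {u} 0<d ≤-refl inU))) (n∣m⇒m%n≡0 A₂ b b∣A₂)
      e≡N₂+d : e % b ≡ (N₂ + d) % b
      e≡N₂+d = trans (sym (%-remove-+ˡ e b∣A₂)) (trans (cong (_% b) A₂+e≡) (advance-% N₂ d))

    gap-eventually-constant : ∀ {L} κ .{{_ : NonZero L}} → CommonMult b L →
      ∃ λ K → 2 ≤ K × ∀ k → K ≤ k → InClass L k κ → gap e (b ^ k) ≡ gap e (b ^ K)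
    gap-eventually-constant {L} κ common
      with powMod-periodic b (Sig b d u) L (subst (0 <_) (sym Sig≡cycleSum-entry) (0<cycleSum e))
             (λ l per → common d u l 0<d d<b (inj₁ inU) per)
    ... | K₀ , periodic = K , 2≤K , stable
      where
      open Classes L
      K : ℕ
      K = κ + (K₀ + 2) * L
      2≤K : 2 ≤ K
      2≤K = ≤-trans (m≤n+m 2 K₀) (Q≤κ+Q*L κ (K₀ + 2))
      K₀≤K : K₀ ≤ K
      K₀≤K = ≤-trans (m≤m+n K₀ 2) (Q≤κ+Q*L κ (K₀ + 2))
      e<b^ : ∀ {k} → 2 ≤ k → e < b ^ k
      e<b^ 2≤k = <-≤-trans e<b^2 (b^2≤b^k 2≤k)
      modN≡%cycleSum : ∀ x → modN x (Sig b d u) ≡ x % cycleSum e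
      modN≡%cycleSum x = trans (cong (modN x) Sig≡cycleSum-entry) (modN≡% x (cycleSum e))
      stable : ∀ k → K ≤ k → InClass L k κ → gap e (b ^ k) ≡ gap e (b ^ K)
      stable k K≤k cls with InClass-beyond (K₀ + 2) K≤k cls
      ... | p , refl = gap-% (e<b^ (≤-trans 2≤K K≤k)) (e<b^ 2≤K)
        (trans (sym (modN≡%cycleSum _)) (trans (periodic K p K₀≤K) (modN≡%cycleSum _)))

    wellDefinedAt : ∀ {L κ} .{{_ : NonZero L}} → κ < L → CommonMult b L → WellDefinedAt b L d u κ
    wellDefinedAt {L} {κ} κ<L common with gap-eventually-constant κ common
    ... | K , 2≤K , stable with InU? (nextDigit d) (gap e (b ^ K))
    ...   | no ¬inU' = K , inj₁ λ k K≤k cls d' u' k' edge →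
      let d'≡ , _ , u'≡ = edge⇒ (≤-trans 2≤K K≤k) edge
      in ¬inU' (subst₂ (InU b) d'≡ (trans u'≡ (stable k K≤k cls)) (proj₁ (proj₂ edge)))
    ...   | yes inU' = K , inj₂ (nextDigit d , gap e (b ^ K) , (κ + carry d) % L , m%n<n _ L , exists , determined)
      where
      exists : ∀ k → K ≤ k → InClass L k κ → ∃ λ k' → Edge b d u k (nextDigit d) (gap e (b ^ K)) k'
      exists k K≤k cls = k + carry d ,
        edge-intro {d} {u} {k} d<b inU' (subst (LastGap d u k) (stable k K≤k cls) (lastGap (≤-trans 2≤K K≤k)))
      determined : ∀ k → K ≤ k → InClass L k κ → ∀ d' u' k' → Edge b d u k d' u' k' →
        d' ≡ nextDigit d × u' ≡ gap e (b ^ K) × InClass L k' ((κ + carry d) % L)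
      determined k K≤k cls d' u' k' edge with edge⇒ (≤-trans 2≤K K≤k) edge
      ... | d'≡ , refl , u'≡ = d'≡ , trans u'≡ (stable k K≤k cls) , Classes.InClass-+ L (carry d) cls

  wellDefined : ∀ {L} → IsL b L → ∀ d u κ → IsVtx' b L d u κ → WellDefinedAt b L d u κ
  wellDefined (common , _) d u κ ((0<d , d<b , inU) , κ<L) with entry {d} {u} 0<d d<b inU
  ... | inj₂ stops = 2 , inj₁ λ k 2≤k _ d' u' k' → terminates-noEdge {d} {u} {k} 0<d d<b inU stops 2≤k
  ... | inj₁ (e , e<b^2 , enters) = Entering.wellDefinedAt 0<d d<b inU e<b^2 enters {{<⇒nonZero κ<L}} κ<L common

  largeInClass : ∀ {L} κ K₁ K₂ → κ < L → let k = κ + (K₁ + K₂ + 2) * L in K₁ ≤ k × K₂ ≤ k × 2 ≤ k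
  largeInClass {L} κ K₁ K₂ κ<L = ≤-trans (≤-trans (m≤m+n K₁ K₂) (m≤m+n _ 2)) Q≤k ,
                          ≤-trans (≤-trans (m≤n+m K₂ K₁) (m≤m+n _ 2)) Q≤k ,
                          ≤-trans (m≤n+m 2 (K₁ + K₂)) Q≤k
    where Q≤k : K₁ + K₂ + 2 ≤ κ + (K₁ + K₂ + 2) * L
          Q≤k = Classes.Q≤κ+Q*L L {{<⇒nonZero κ<L}} κ (K₁ + K₂ + 2)

  outDegree≤1 : ∀ {L} d u κ d₁ u₁ κ₁ d₂ u₂ κ₂ →
    IsVtx' b L d u κ → IsVtx' b L d₁ u₁ κ₁ → IsVtx' b L d₂ u₂ κ₂ →
    Edge' b L d u κ d₁ u₁ κ₁ → Edge' b L d u κ d₂ u₂ κ₂ →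
    d₁ ≡ d₂ × u₁ ≡ u₂ × κ₁ ≡ κ₂
  outDegree≤1 {L} d u κ d₁ u₁ κ₁ d₂ u₂ κ₂ ((_ , d<b , _) , κ<L) (_ , κ₁<L) (_ , κ₂<L)
              (K₁ , edges₁) (K₂ , edges₂) with largeInClass κ K₁ K₂ κ<L
  ... | K₁≤k , K₂≤k , 2≤k with edges₁ _ K₁≤k (K₁ + K₂ + 2 , refl) | edges₂ _ K₂≤k (K₁ + K₂ + 2 , refl)
  ... | _ , cls₁ , edge₁ | _ , cls₂ , edge₂ with edge-inv {d} {u} d<b edge₁ | edge-inv {d} {u} d<b edge₂
  ... | refl , refl , inU₁ , last₁ | refl , refl , inU₂ , last₂ =
    refl ,
    LastGap-unique {d} {u} {κ + (K₁ + K₂ + 2) * L} (InU⇒≤top d 2≤k inU₁) (InU⇒≤top d 2≤k inU₂) last₁ last₂ ,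
    Classes.InClass-unique L {{<⇒nonZero κ<L}} κ₁<L κ₂<L cls₁ cls₂

  inDegree≤1 : ∀ {L} d u κ d₁ u₁ κ₁ d₂ u₂ κ₂ →
    IsVtx' b L d u κ → IsVtx' b L d₁ u₁ κ₁ → IsVtx' b L d₂ u₂ κ₂ →
    Edge' b L d₁ u₁ κ₁ d u κ → Edge' b L d₂ u₂ κ₂ d u κ →
    d₁ ≡ d₂ × u₁ ≡ u₂ × κ₁ ≡ κ₂
  inDegree≤1 {L} d u κ d₁ u₁ κ₁ d₂ u₂ κ₂ (_ , κ<L) ((0<d₁ , d₁<b , inU₁) , κ₁<L) ((0<d₂ , d₂<b , inU₂) , κ₂<L)
             (K₁ , edges₁) (K₂ , edges₂) with largeInClass κ₁ K₁ K₂ κ₁<L | largeInClass κ₂ K₁ K₂ κ₂<L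
  ... | K₁≤k₁ , _ , 2≤k | _ , K₂≤k₂ , _
    with edges₁ _ K₁≤k₁ (K₁ + K₂ + 2 , refl) | edges₂ _ K₂≤k₂ (K₁ + K₂ + 2 , refl)
  ... | _ , cls₁ , edge₁ | _ , cls₂ , edge₂ with edge-inv {d₁} {u₁} d₁<b edge₁ | edge-inv {d₂} {u₂} d₂<b edge₂
  ... | d≡₁ , refl , _ , last₁ | d≡₂ , refl , _ , last₂
    with nextDigit-injective 0<d₁ 0<d₂ d₁<b d₂<b (trans (sym d≡₁) d≡₂)
  ... | refl with Classes.InClass-cancel L {{<⇒nonZero κ<L}} (K₁ + K₂ + 2) (carry d₁) κ₁<L κ₂<L cls₁ cls₂
  ... | refl = refl , source-unique 0<d₁ d₁<b inU₁ inU₂ 2≤k last₁ last₂ , refl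

lemma2 : (b : ℕ) .{{_ : NonZero b}} → 2 < b → (L : ℕ) → IsL b L →
    (∀ d u κ → IsVtx' b L d u κ → WellDefinedAt b L d u κ)
  × (∀ d u κ d₁ u₁ κ₁ d₂ u₂ κ₂ → IsVtx' b L d u κ →
       IsVtx' b L d₁ u₁ κ₁ → IsVtx' b L d₂ u₂ κ₂ →
       Edge' b L d u κ d₁ u₁ κ₁ → Edge' b L d u κ d₂ u₂ κ₂ →
       d₁ ≡ d₂ × u₁ ≡ u₂ × κ₁ ≡ κ₂)
  × (∀ d u κ d₁ u₁ κ₁ d₂ u₂ κ₂ → IsVtx' b L d u κ →
       IsVtx' b L d₁ u₁ κ₁ → IsVtx' b L d₂ u₂ κ₂ →
       Edge' b L d₁ u₁ κ₁ d u κ → Edge' b L d₂ u₂ κ₂ d u κ →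
       d₁ ≡ d₂ × u₁ ≡ u₂ × κ₁ ≡ κ₂)
lemma2 b 2<b L isL = wellDefined isL , outDegree≤1 , inDegree≤1
  where open Digraph b (<-trans (n<1+n 1) 2<b)
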